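{- Let $m \geq 3$ be odd and $n$ be even. There exists an $SMA(m,n)$ such that for every $x \in \{1, 2, \ldots, mn/2\}$ the entries $x$ and $-x$ appear in the same row if and only if either $m \equiv 0, 3 \pmod 4$ and $n = 2$, or $m \geq 3$ and $n \geq 4$.
   Context: For positive integers $m,n$ with $mn$ even, a (tight) signed magic array $SMA(m,n)$ is an $m \times n$ array with no empty cells whose entries are the elements of $X=\{\pm 1, \pm 2, \ldots, \pm mn/2\}$, each element of $X$ appearing exactly once, such that the entries of every row and of every column sum to $0$. -}

module Defs where

open import Data.Nat using (ℕ; zero; suc)
import Data.Nat as ℕ
open import Data.Nat.DivMod using (_/_)
open import Data.Integer using (ℤ; +_; -_; _+_; ∣_∣; 0ℤ)
open import Data.Fin using (Fin)
import Data.Fin as Fin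
open import Data.Product using (Σ; _×_; ∃; ∃-syntax)
open import Relation.Binary.PropositionalEquality using (_≡_; _≢_)

ΣFin : (n : ℕ) → (Fin n → ℤ) → ℤ
ΣFin zero    f = 0ℤ
ΣFin (suc n) f = f Fin.zero + ΣFin n (λ i → f (Fin.suc i))

Array : ℕ → ℕ → Set
Array m n = Fin m → Fin n → ℤ

half : ℕ → ℕ → ℕ
half m n = (m ℕ.* n) / 2

InX : ℕ → ℕ → ℤ → Set
InX m n x = (x ≢ 0ℤ) × (∣ x ∣ ℕ.≤ half m n)

record IsSMA (m n : ℕ) (A : Array m n) : Set where
  field
    entriesInX : ∀ i j → InX m n (A i j)
    appearsOnce : ∀ x → InX m n x →
      ∃[ i ] ∃[ j ] ((A i j ≡ x) ×
        (∀ i' j' → A i' j' ≡ x → (i' ≡ i) × (j' ≡ j)))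
    rowSums : ∀ i → ΣFin n (λ j → A i j) ≡ 0ℤ
    colSums : ∀ j → ΣFin m (λ i → A i j) ≡ 0ℤ

PairsInSameRow : (m n : ℕ) → Array m n → Set
PairsInSameRow m n A = ∀ (x : ℕ) → 1 ℕ.≤ x → x ℕ.≤ half m n →
  ∃[ i ] ∃[ j ] ∃[ j' ] (A i j ≡ + x) × (A i j' ≡ - (+ x))

-- Every row is made of pairs x, -x, so the row sums vanish and only the columns need work.
-- Stacking a block under another and adding K to its magnitudes adds K times its column
-- sign sums to the column sums; these sign sums vanish for two-row blocks with one positive
-- and one negative entry per column, and for the four rows ρ, -ρ, -ρ, ρ, which moreover have
-- zero column sums. Hence it suffices to build 3 × 2t arrays for t ≥ 1 and 5 × 2t arrays for
-- t ≥ 2: the row t, -t, …, 1, -1 (possibly with its columns permuted) on top of two-row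
-- blocks whose column differences cancel it. Conversely, the first column of an SMA(m, 2) is
-- a signing of 1, …, m with sum 0, so 1 + ⋯ + m is even, which fails for m ≡ 1 (mod 4).

module Submission where

open import Defs
open import Data.Nat using (ℕ; zero; suc; _+_; _*_; _∸_; _≤_; _<_; _%_; z≤n; s≤s; _≤?_; _<?_)
import Data.Nat as ℕ
import Data.Nat.Properties as ℕP
open import Data.Nat.DivMod using (_/_; m*n/n≡m; m≡m%n+[m/n]*n; m%n<n)
open import Data.Nat.Divisibility using (_∣_; divides)
open import Data.Nat.Tactic.RingSolver renaming (solve-∀ to ℕ-solve)
open import Data.Integer using (ℤ; +_; -[1+_]; +[1+_]; ∣_∣; 0ℤ; 1ℤ; -1ℤ; -_) renaming (_+_ to _+ℤ_; _*_ to _*ℤ_; _-_ to _-ℤ_)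
import Data.Integer as ℤ
import Data.Integer.Properties as ℤP
open import Data.Integer.Tactic.RingSolver using (solve-∀)
open import Data.Fin using (Fin; toℕ; fromℕ<)
import Data.Fin as Fin
import Data.Fin.Properties as FinP
open import Data.Fin.Permutation using (Permutation; permutation)
open import Algebra.Properties.CommutativeMonoid.Sum ℤP.+-0-commutativeMonoid using (sum; sum-permute; sum-cong-≗; ∑-distrib-+)
open import Data.Product using (Σ; _×_; _,_; proj₁; proj₂; ∃; ∃-syntax)
open import Data.Sum using (_⊎_; inj₁; inj₂)
open import Data.Bool using (Bool; true; false)
import Data.Bool.Properties as Bool
open import Data.Empty using (⊥; ⊥-elim)
open import Relation.Nullary using (¬_; yes; no; Dec; ¬?; _×-dec_)
open import Relation.Nullary.Decidable using (True; toWitness)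
open import Relation.Binary.PropositionalEquality using (_≡_; _≢_; refl; sym; trans; cong; cong₂; subst; subst₂; module ≡-Reasoning)
open import Function.Base using (id)
open import Function.Bundles using (_⇔_; mk⇔)
open import Function.Definitions using (Injective)

∑< : ℕ → (ℕ → ℤ) → ℤ
∑< zero    f = 0ℤ
∑< (suc n) f = f 0 +ℤ ∑< n (λ i → f (suc i))

∑<-cong : ∀ n {f g : ℕ → ℤ} → (∀ i → i < n → f i ≡ g i) → ∑< n f ≡ ∑< n g
∑<-cong zero    f≡g = refl
∑<-cong (suc n) f≡g = cong₂ _+ℤ_ (f≡g 0 (s≤s z≤n)) (∑<-cong n (λ i i<n → f≡g (suc i) (s≤s i<n)))

∑<-split : ∀ a b (f : ℕ → ℤ) → ∑< (a + b) f ≡ ∑< a f +ℤ ∑< b (λ i → f (a + i))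
∑<-split zero    b f = sym (ℤP.+-identityˡ _)
∑<-split (suc a) b f = trans (cong (f 0 +ℤ_) (∑<-split a b (λ i → f (suc i)))) (sym (ℤP.+-assoc (f 0) _ _))

+ℤ-interchange : ∀ (a b c d : ℤ) → (a +ℤ b) +ℤ (c +ℤ d) ≡ (a +ℤ c) +ℤ (b +ℤ d)
+ℤ-interchange = solve-∀

∑<-distrib-+ : ∀ n (f g : ℕ → ℤ) → ∑< n (λ i → f i +ℤ g i) ≡ ∑< n f +ℤ ∑< n g
∑<-distrib-+ zero    f g = refl
∑<-distrib-+ (suc n) f g =
  trans (cong ((f 0 +ℤ g 0) +ℤ_) (∑<-distrib-+ n (λ i → f (suc i)) (λ i → g (suc i))))
        (+ℤ-interchange (f 0) (g 0) _ _)

∑<-*ˡ : ∀ n c (f : ℕ → ℤ) → ∑< n (λ i → c *ℤ f i) ≡ c *ℤ ∑< n f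
∑<-*ˡ zero    c f = sym (ℤP.*-zeroʳ c)
∑<-*ˡ (suc n) c f = trans (cong (c *ℤ f 0 +ℤ_) (∑<-*ˡ n c _)) (sym (ℤP.*-distribˡ-+ c (f 0) _))

∑<-neg : ∀ n (f : ℕ → ℤ) → ∑< n (λ i → - f i) ≡ - ∑< n f
∑<-neg zero    f = refl
∑<-neg (suc n) f = trans (cong (- f 0 +ℤ_) (∑<-neg n _)) (sym (ℤP.neg-distrib-+ (f 0) _))

ΣFin≡∑< : ∀ n (f : ℕ → ℤ) → ΣFin n (λ j → f (toℕ j)) ≡ ∑< n f
ΣFin≡∑< zero    f = refl
ΣFin≡∑< (suc n) f = cong (f 0 +ℤ_) (ΣFin≡∑< n (λ i → f (suc i)))

ΣFin≡sum : ∀ n (f : Fin n → ℤ) → ΣFin n f ≡ sum f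
ΣFin≡sum zero    f = refl
ΣFin≡sum (suc n) f = cong (f Fin.zero +ℤ_) (ΣFin≡sum n (λ i → f (Fin.suc i)))

sgn : ℤ → ℤ
sgn (+ zero)  = 0ℤ
sgn +[1+ n ] = 1ℤ
sgn -[1+ n ] = -1ℤ

shift : ℕ → ℤ → ℤ
shift K (+ zero)  = + zero
shift K +[1+ n ] = +[1+ n + K ]
shift K -[1+ n ] = -[1+ n + K ]

unshift : ℕ → ℤ → ℤ
unshift K (+ zero)  = + zero
unshift K +[1+ n ] = +[1+ n ∸ K ]
unshift K -[1+ n ] = -[1+ n ∸ K ]

InPM : ℕ → ℤ → Set
InPM K x = (x ≢ 0ℤ) × (∣ x ∣ ≤ K)

shift-linear : ∀ K x → shift K x ≡ x +ℤ (+ K) *ℤ sgn x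
shift-linear K (+ zero)  = sym (trans (ℤP.+-identityˡ _) (ℤP.*-zeroʳ (+ K)))
shift-linear K +[1+ n ] = trans (ℤP.pos-+ (suc n) K) (cong (+[1+ n ] +ℤ_) (sym (ℤP.*-identityʳ (+ K))))
shift-linear K -[1+ n ] = begin
    -[1+ n + K ]                   ≡⟨ cong -_ (ℤP.pos-+ (suc n) K) ⟩
    - (+[1+ n ] +ℤ + K)            ≡⟨ ℤP.neg-distrib-+ +[1+ n ] (+ K) ⟩
    -[1+ n ] +ℤ - (+ K)            ≡⟨ cong (-[1+ n ] +ℤ_) (trans (sym (ℤP.-1*i≡-i (+ K))) (ℤP.*-comm -1ℤ (+ K))) ⟩
    -[1+ n ] +ℤ (+ K) *ℤ -1ℤ ∎
  where open ≡-Reasoning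

sgn-shift : ∀ K x → sgn (shift K x) ≡ sgn x
sgn-shift K (+ zero)  = refl
sgn-shift K +[1+ n ] = refl
sgn-shift K -[1+ n ] = refl

sgn-neg : ∀ x → sgn (- x) ≡ - sgn x
sgn-neg (+ zero)  = refl
sgn-neg +[1+ n ] = refl
sgn-neg -[1+ n ] = refl

shift-neg : ∀ K x → shift K (- x) ≡ - shift K x
shift-neg K (+ zero)  = refl
shift-neg K +[1+ n ] = refl
shift-neg K -[1+ n ] = refl

unshift-shift : ∀ K x → unshift K (shift K x) ≡ x
unshift-shift K (+ zero)  = refl
unshift-shift K +[1+ n ] = cong +[1+_] (ℕP.m+n∸n≡m n K)
unshift-shift K -[1+ n ] = cong -[1+_] (ℕP.m+n∸n≡m n K)

shift-unshift : ∀ K x → K < ∣ x ∣ → shift K (unshift K x) ≡ x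
shift-unshift K +[1+ n ] (s≤s K≤n) = cong +[1+_] (ℕP.m∸n+n≡m K≤n)
shift-unshift K -[1+ n ] (s≤s K≤n) = cong -[1+_] (ℕP.m∸n+n≡m K≤n)

neg-≢0 : ∀ {x} → x ≢ 0ℤ → - x ≢ 0ℤ
neg-≢0 {+ zero}    x≢0 = x≢0
neg-≢0 {+[1+ n ]} _   ()
neg-≢0 { -[1+ n ]} _  ()

InPM-neg : ∀ {K x} → InPM K x → InPM K (- x)
InPM-neg {K} {x} (x≢0 , ∣x∣≤K) = neg-≢0 x≢0 , subst (_≤ K) (sym (ℤP.∣-i∣≡∣i∣ x)) ∣x∣≤K

InPM-mono : ∀ {K K' x} → K ≤ K' → InPM K x → InPM K' x
InPM-mono K≤K' (x≢0 , ∣x∣≤K) = x≢0 , ℕP.≤-trans ∣x∣≤K K≤K'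

InPM-shift : ∀ K₁ K₂ {y} → InPM K₂ y → InPM (K₁ + K₂) (shift K₁ y)
InPM-shift K₁ K₂ {+ zero}    (y≢0 , _) = ⊥-elim (y≢0 refl)
InPM-shift K₁ K₂ {+[1+ n ]} (_ , ∣y∣≤K₂) = (λ ()) , subst (_≤ K₁ + K₂) (ℕP.+-comm K₁ (suc n)) (ℕP.+-monoʳ-≤ K₁ ∣y∣≤K₂)
InPM-shift K₁ K₂ { -[1+ n ]} (_ , ∣y∣≤K₂) = (λ ()) , subst (_≤ K₁ + K₂) (ℕP.+-comm K₁ (suc n)) (ℕP.+-monoʳ-≤ K₁ ∣y∣≤K₂)

shift-> : ∀ K {y} → y ≢ 0ℤ → K < ∣ shift K y ∣
shift-> K {+ zero}    y≢0 = ⊥-elim (y≢0 refl)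
shift-> K {+[1+ n ]} _   = s≤s (ℕP.m≤n+m K n)
shift-> K { -[1+ n ]} _  = s≤s (ℕP.m≤n+m K n)

suc∸≤ : ∀ {K₁ K₂ n} → K₁ ≤ n → suc n ≤ K₁ + K₂ → suc (n ∸ K₁) ≤ K₂
suc∸≤ {K₁} {K₂} K₁≤n le =
  subst (_≤ K₂) (ℕP.+-∸-assoc 1 K₁≤n) (subst (_ ∸ K₁ ≤_) (ℕP.m+n∸m≡n K₁ K₂) (ℕP.∸-monoˡ-≤ K₁ le))

InPM-unshift : ∀ K₁ K₂ {x} → InPM (K₁ + K₂) x → K₁ < ∣ x ∣ → InPM K₂ (unshift K₁ x)
InPM-unshift K₁ K₂ {+[1+ n ]} (_ , ∣x∣≤) (s≤s K₁≤n) = (λ ()) , suc∸≤ K₁≤n ∣x∣≤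
InPM-unshift K₁ K₂ { -[1+ n ]} (_ , ∣x∣≤) (s≤s K₁≤n) = (λ ()) , suc∸≤ K₁≤n ∣x∣≤

-- Blocks and stacking

-- Arrays are indexed by ℕ; rowOf and colOf locate each element of ±[1, bound], so it occurs exactly once.
record Block (r n : ℕ) : Set where
  field
    entry       : ℕ → ℕ → ℤ
    bound       : ℕ
    rowOf colOf : ℤ → ℕ
    entry-InPM  : ∀ {i j} → i < r → j < n → InPM bound (entry i j)
    rowOf<      : ∀ {x} → InPM bound x → rowOf x < r
    colOf<      : ∀ {x} → InPM bound x → colOf x < n
    entry-at    : ∀ {x} → InPM bound x → entry (rowOf x) (colOf x) ≡ x
    rowOf-entry : ∀ {i j} → i < r → j < n → rowOf (entry i j) ≡ i
    colOf-entry : ∀ {i j} → i < r → j < n → colOf (entry i j) ≡ j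
    rowOf-neg   : ∀ {i j} → i < r → j < n → rowOf (- entry i j) ≡ i

colSum : ∀ {r n} → Block r n → ℕ → ℤ
colSum {r} B j = ∑< r (λ i → Block.entry B i j)

colSgnSum : ∀ {r n} → Block r n → ℕ → ℤ
colSgnSum {r} B j = ∑< r (λ i → sgn (Block.entry B i j))

data RowView (r₁ : ℕ) : ℕ → Set where
  upper : ∀ {i} → i < r₁ → RowView r₁ i
  lower : ∀ k → RowView r₁ (r₁ + k)

rowView : ∀ r₁ i → RowView r₁ i
rowView r₁ i with i <? r₁
... | yes i<r₁ = upper i<r₁
... | no  i≮r₁ = subst (RowView r₁) (ℕP.m+[n∸m]≡n (ℕP.≮⇒≥ i≮r₁)) (lower (i ∸ r₁))

stackEntry : ℕ → ℕ → (ℕ → ℕ → ℤ) → (ℕ → ℕ → ℤ) → ℕ → ℕ → ℤ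
stackEntry r₁ K₁ A₁ A₂ i j with i <? r₁
... | yes _ = A₁ i j
... | no  _ = shift K₁ (A₂ (i ∸ r₁) j)

stackEntry-upper : ∀ r₁ K₁ A₁ A₂ {i} j → i < r₁ → stackEntry r₁ K₁ A₁ A₂ i j ≡ A₁ i j
stackEntry-upper r₁ K₁ A₁ A₂ {i} j i<r₁ with i <? r₁
... | yes _    = refl
... | no  i≮r₁ = ⊥-elim (i≮r₁ i<r₁)

stackEntry-lower : ∀ r₁ K₁ A₁ A₂ k j → stackEntry r₁ K₁ A₁ A₂ (r₁ + k) j ≡ shift K₁ (A₂ k j)
stackEntry-lower r₁ K₁ A₁ A₂ k j with r₁ + k <? r₁
... | yes r₁+k<r₁ = ⊥-elim (ℕP.m+n≮m r₁ k r₁+k<r₁)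
... | no  _       = cong (λ z → shift K₁ (A₂ z j)) (ℕP.m+n∸m≡n r₁ k)

stackLoc : ℕ → ℕ → (ℤ → ℕ) → (ℤ → ℕ) → ℤ → ℕ
stackLoc r₁ K₁ l₁ l₂ x with ∣ x ∣ ≤? K₁
... | yes _ = l₁ x
... | no  _ = r₁ + l₂ (unshift K₁ x)

stackLoc-small : ∀ r₁ K₁ l₁ l₂ {x} → ∣ x ∣ ≤ K₁ → stackLoc r₁ K₁ l₁ l₂ x ≡ l₁ x
stackLoc-small r₁ K₁ l₁ l₂ {x} ∣x∣≤K₁ with ∣ x ∣ ≤? K₁
... | yes _    = refl
... | no  ∣x∣≰ = ⊥-elim (∣x∣≰ ∣x∣≤K₁)

stackLoc-large : ∀ r₁ K₁ l₁ l₂ {x} → K₁ < ∣ x ∣ → stackLoc r₁ K₁ l₁ l₂ x ≡ r₁ + l₂ (unshift K₁ x)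
stackLoc-large r₁ K₁ l₁ l₂ {x} K₁<∣x∣ with ∣ x ∣ ≤? K₁
... | yes ∣x∣≤K₁ = ⊥-elim (ℕP.<⇒≱ K₁<∣x∣ ∣x∣≤K₁)
... | no  _      = refl

stackLoc-shift : ∀ r₁ K₁ l₁ l₂ {y} → y ≢ 0ℤ → stackLoc r₁ K₁ l₁ l₂ (shift K₁ y) ≡ r₁ + l₂ y
stackLoc-shift r₁ K₁ l₁ l₂ {y} y≢0 =
  trans (stackLoc-large r₁ K₁ l₁ l₂ (shift-> K₁ y≢0)) (cong (λ z → r₁ + l₂ z) (unshift-shift K₁ y))

module Stack {r₁ r₂ n} (B₁ : Block r₁ n) (B₂ : Block r₂ n) where
  private
    module B₁ = Block B₁
    module B₂ = Block B₂

  K₁ K₂ : ℕ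
  K₁ = B₁.bound
  K₂ = B₂.bound

  A : ℕ → ℕ → ℤ
  A = stackEntry r₁ K₁ B₁.entry B₂.entry

  rowOf colOf : ℤ → ℕ
  rowOf = stackLoc r₁ K₁ B₁.rowOf B₂.rowOf
  colOf = stackLoc 0 K₁ B₁.colOf B₂.colOf

  upperEntry : ∀ {i} j → i < r₁ → A i j ≡ B₁.entry i j
  upperEntry = stackEntry-upper r₁ K₁ B₁.entry B₂.entry
  lowerEntry : ∀ k j → A (r₁ + k) j ≡ shift K₁ (B₂.entry k j)
  lowerEntry = stackEntry-lower r₁ K₁ B₁.entry B₂.entry
  k<r₂ : ∀ {k} → r₁ + k < r₁ + r₂ → k < r₂
  k<r₂ = ℕP.+-cancelˡ-< r₁ _ _

  entry-InPM : ∀ {i j} → i < r₁ + r₂ → j < n → InPM (K₁ + K₂) (A i j)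
  entry-InPM {i} {j} i< j< with rowView r₁ i
  ... | upper i<r₁ = subst (InPM (K₁ + K₂)) (sym (upperEntry j i<r₁))
                       (InPM-mono (ℕP.m≤m+n K₁ K₂) (B₁.entry-InPM i<r₁ j<))
  ... | lower k    = subst (InPM (K₁ + K₂)) (sym (lowerEntry k j)) (InPM-shift K₁ K₂ (B₂.entry-InPM (k<r₂ i<) j<))

  rowOf< : ∀ {x} → InPM (K₁ + K₂) x → rowOf x < r₁ + r₂
  rowOf< {x} x∈ with ℕP.≤-<-connex ∣ x ∣ K₁
  ... | inj₁ ∣x∣≤K₁ = subst (_< r₁ + r₂) (sym (stackLoc-small r₁ K₁ B₁.rowOf B₂.rowOf ∣x∣≤K₁))
                        (ℕP.<-≤-trans (B₁.rowOf< (proj₁ x∈ , ∣x∣≤K₁)) (ℕP.m≤m+n r₁ r₂))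
  ... | inj₂ K₁<∣x∣ = subst (_< r₁ + r₂) (sym (stackLoc-large r₁ K₁ B₁.rowOf B₂.rowOf K₁<∣x∣))
                        (ℕP.+-monoʳ-< r₁ (B₂.rowOf< (InPM-unshift K₁ K₂ x∈ K₁<∣x∣)))

  colOf< : ∀ {x} → InPM (K₁ + K₂) x → colOf x < n
  colOf< {x} x∈ with ℕP.≤-<-connex ∣ x ∣ K₁
  ... | inj₁ ∣x∣≤K₁ = subst (_< n) (sym (stackLoc-small 0 K₁ B₁.colOf B₂.colOf ∣x∣≤K₁)) (B₁.colOf< (proj₁ x∈ , ∣x∣≤K₁))
  ... | inj₂ K₁<∣x∣ = subst (_< n) (sym (stackLoc-large 0 K₁ B₁.colOf B₂.colOf K₁<∣x∣))
                        (B₂.colOf< (InPM-unshift K₁ K₂ x∈ K₁<∣x∣))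

  entry-at : ∀ {x} → InPM (K₁ + K₂) x → A (rowOf x) (colOf x) ≡ x
  entry-at {x} x∈ with ℕP.≤-<-connex ∣ x ∣ K₁
  ... | inj₁ ∣x∣≤K₁ = begin
        A (rowOf x) (colOf x)
          ≡⟨ cong₂ A (stackLoc-small r₁ K₁ B₁.rowOf B₂.rowOf ∣x∣≤K₁) (stackLoc-small 0 K₁ B₁.colOf B₂.colOf ∣x∣≤K₁) ⟩
        A (B₁.rowOf x) (B₁.colOf x)         ≡⟨ upperEntry (B₁.colOf x) (B₁.rowOf< x∈₁) ⟩
        B₁.entry (B₁.rowOf x) (B₁.colOf x) ≡⟨ B₁.entry-at x∈₁ ⟩
        x ∎
    where open ≡-Reasoning
          x∈₁ = proj₁ x∈ , ∣x∣≤K₁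
  ... | inj₂ K₁<∣x∣ = begin
        A (rowOf x) (colOf x)
          ≡⟨ cong₂ A (stackLoc-large r₁ K₁ B₁.rowOf B₂.rowOf K₁<∣x∣) (stackLoc-large 0 K₁ B₁.colOf B₂.colOf K₁<∣x∣) ⟩
        A (r₁ + B₂.rowOf y) (B₂.colOf y)            ≡⟨ lowerEntry (B₂.rowOf y) (B₂.colOf y) ⟩
        shift K₁ (B₂.entry (B₂.rowOf y) (B₂.colOf y)) ≡⟨ cong (shift K₁) (B₂.entry-at (InPM-unshift K₁ K₂ x∈ K₁<∣x∣)) ⟩
        shift K₁ y                                 ≡⟨ shift-unshift K₁ x K₁<∣x∣ ⟩
        x ∎
    where open ≡-Reasoning
          y = unshift K₁ x

  rowOf-entry : ∀ {i j} → i < r₁ + r₂ → j < n → rowOf (A i j) ≡ i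
  rowOf-entry {i} {j} i< j< with rowView r₁ i
  ... | upper i<r₁ = begin
        rowOf (A i j)            ≡⟨ cong rowOf (upperEntry j i<r₁) ⟩
        rowOf (B₁.entry i j)     ≡⟨ stackLoc-small r₁ K₁ B₁.rowOf B₂.rowOf (proj₂ (B₁.entry-InPM i<r₁ j<)) ⟩
        B₁.rowOf (B₁.entry i j) ≡⟨ B₁.rowOf-entry i<r₁ j< ⟩
        i ∎
    where open ≡-Reasoning
  ... | lower k = begin
        rowOf (A (r₁ + k) j)                ≡⟨ cong rowOf (lowerEntry k j) ⟩
        rowOf (shift K₁ (B₂.entry k j))     ≡⟨ stackLoc-shift r₁ K₁ B₁.rowOf B₂.rowOf (proj₁ (B₂.entry-InPM k< j<)) ⟩
        r₁ + B₂.rowOf (B₂.entry k j)        ≡⟨ cong (λ z → r₁ + z) (B₂.rowOf-entry k< j<) ⟩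
        r₁ + k ∎
    where open ≡-Reasoning
          k< = k<r₂ i<

  colOf-entry : ∀ {i j} → i < r₁ + r₂ → j < n → colOf (A i j) ≡ j
  colOf-entry {i} {j} i< j< with rowView r₁ i
  ... | upper i<r₁ = begin
        colOf (A i j)            ≡⟨ cong colOf (upperEntry j i<r₁) ⟩
        colOf (B₁.entry i j)     ≡⟨ stackLoc-small 0 K₁ B₁.colOf B₂.colOf (proj₂ (B₁.entry-InPM i<r₁ j<)) ⟩
        B₁.colOf (B₁.entry i j) ≡⟨ B₁.colOf-entry i<r₁ j< ⟩
        j ∎
    where open ≡-Reasoning
  ... | lower k = begin
        colOf (A (r₁ + k) j)                ≡⟨ cong colOf (lowerEntry k j) ⟩
        colOf (shift K₁ (B₂.entry k j))     ≡⟨ stackLoc-shift 0 K₁ B₁.colOf B₂.colOf (proj₁ (B₂.entry-InPM k< j<)) ⟩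
        B₂.colOf (B₂.entry k j)             ≡⟨ B₂.colOf-entry k< j< ⟩
        j ∎
    where open ≡-Reasoning
          k< = k<r₂ i<

  rowOf-neg : ∀ {i j} → i < r₁ + r₂ → j < n → rowOf (- A i j) ≡ i
  rowOf-neg {i} {j} i< j< with rowView r₁ i
  ... | upper i<r₁ = begin
        rowOf (- A i j)            ≡⟨ cong (λ z → rowOf (- z)) (upperEntry j i<r₁) ⟩
        rowOf (- B₁.entry i j)     ≡⟨ stackLoc-small r₁ K₁ B₁.rowOf B₂.rowOf (proj₂ (InPM-neg (B₁.entry-InPM i<r₁ j<))) ⟩
        B₁.rowOf (- B₁.entry i j) ≡⟨ B₁.rowOf-neg i<r₁ j< ⟩
        i ∎
    where open ≡-Reasoning
  ... | lower k = begin
        rowOf (- A (r₁ + k) j)              ≡⟨ cong (λ z → rowOf (- z)) (lowerEntry k j) ⟩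
        rowOf (- shift K₁ (B₂.entry k j))   ≡⟨ cong rowOf (sym (shift-neg K₁ (B₂.entry k j))) ⟩
        rowOf (shift K₁ (- B₂.entry k j))   ≡⟨ stackLoc-shift r₁ K₁ B₁.rowOf B₂.rowOf (proj₁ (InPM-neg (B₂.entry-InPM k< j<))) ⟩
        r₁ + B₂.rowOf (- B₂.entry k j)      ≡⟨ cong (λ z → r₁ + z) (B₂.rowOf-neg k< j<) ⟩
        r₁ + k ∎
    where open ≡-Reasoning
          k< = k<r₂ i<

  block : Block (r₁ + r₂) n
  block = record
    { entry = A ; bound = K₁ + K₂ ; rowOf = rowOf ; colOf = colOf
    ; entry-InPM = entry-InPM ; rowOf< = rowOf< ; colOf< = colOf< ; entry-at = entry-at
    ; rowOf-entry = rowOf-entry ; colOf-entry = colOf-entry ; rowOf-neg = rowOf-neg }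

stack : ∀ {r₁ r₂ n} → Block r₁ n → Block r₂ n → Block (r₁ + r₂) n
stack = Stack.block

colSum-stack : ∀ {r₁ r₂ n} (B₁ : Block r₁ n) (B₂ : Block r₂ n) j →
  colSum (stack B₁ B₂) j ≡ colSum B₁ j +ℤ (colSum B₂ j +ℤ (+ Block.bound B₁) *ℤ colSgnSum B₂ j)
colSum-stack {r₁} {r₂} B₁ B₂ j = begin
    ∑< (r₁ + r₂) (λ i → A i j)
      ≡⟨ ∑<-split r₁ r₂ _ ⟩
    ∑< r₁ (λ i → A i j) +ℤ ∑< r₂ (λ i → A (r₁ + i) j)
      ≡⟨ cong₂ _+ℤ_ (∑<-cong r₁ (λ i i<r₁ → stackEntry-upper r₁ K₁ A₁ A₂ j i<r₁))
                    (∑<-cong r₂ (λ i _ → trans (stackEntry-lower r₁ K₁ A₁ A₂ i j) (shift-linear K₁ (A₂ i j)))) ⟩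
    ∑< r₁ (λ i → A₁ i j) +ℤ ∑< r₂ (λ i → A₂ i j +ℤ (+ K₁) *ℤ sgn (A₂ i j))
      ≡⟨ cong (∑< r₁ (λ i → A₁ i j) +ℤ_) (trans (∑<-distrib-+ r₂ _ _) (cong (∑< r₂ (λ i → A₂ i j) +ℤ_) (∑<-*ˡ r₂ (+ K₁) _))) ⟩
    ∑< r₁ (λ i → A₁ i j) +ℤ (∑< r₂ (λ i → A₂ i j) +ℤ (+ K₁) *ℤ ∑< r₂ (λ i → sgn (A₂ i j))) ∎
  where open ≡-Reasoning
        K₁ = Block.bound B₁
        A₁ = Block.entry B₁
        A₂ = Block.entry B₂
        A  = Block.entry (stack B₁ B₂)

colSgnSum-stack : ∀ {r₁ r₂ n} (B₁ : Block r₁ n) (B₂ : Block r₂ n) j →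
  colSgnSum (stack B₁ B₂) j ≡ colSgnSum B₁ j +ℤ colSgnSum B₂ j
colSgnSum-stack {r₁} {r₂} B₁ B₂ j = trans (∑<-split r₁ r₂ _) (cong₂ _+ℤ_
  (∑<-cong r₁ (λ i i<r₁ → cong sgn (stackEntry-upper r₁ K₁ A₁ A₂ j i<r₁)))
  (∑<-cong r₂ (λ i _ → trans (cong sgn (stackEntry-lower r₁ K₁ A₁ A₂ i j)) (sgn-shift K₁ (A₂ i j)))))
  where K₁ = Block.bound B₁
        A₁ = Block.entry B₁
        A₂ = Block.entry B₂

x≡-x⇒x≡0 : ∀ x → x ≡ - x → x ≡ 0ℤ
x≡-x⇒x≡0 (+ zero)  _ = refl
x≡-x⇒x≡0 +[1+ n ] ()
x≡-x⇒x≡0 -[1+ n ] ()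

-- Negating the entries of a row permutes them, so its sum equals its negative.
module _ {r n} (B : Block r n) {i} (i<r : i < r) where
  open Block B

  private
    row : Fin n → ℤ
    row j = entry i (toℕ j)

    -row∈ : (j : Fin n) → InPM bound (- row j)
    -row∈ j = InPM-neg (entry-InPM i<r (FinP.toℕ<n j))

    partner : Fin n → Fin n
    partner j = fromℕ< (colOf< (-row∈ j))

    toℕ-partner : ∀ j → toℕ (partner j) ≡ colOf (- row j)
    toℕ-partner j = FinP.toℕ-fromℕ< _

    row-partner : ∀ j → row (partner j) ≡ - row j
    row-partner j = begin
        entry i (toℕ (partner j)) ≡⟨ cong (entry i) (toℕ-partner j) ⟩
        entry i (colOf y)         ≡⟨ cong (λ z → entry z (colOf y)) (sym (rowOf-neg i<r (FinP.toℕ<n j))) ⟩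
        entry (rowOf y) (colOf y) ≡⟨ entry-at (-row∈ j) ⟩
        y ∎
      where open ≡-Reasoning
            y = - row j

    partner-involutive : ∀ j → partner (partner j) ≡ j
    partner-involutive j = FinP.toℕ-injective (begin
        toℕ (partner (partner j)) ≡⟨ toℕ-partner (partner j) ⟩
        colOf (- row (partner j)) ≡⟨ cong (λ z → colOf (- z)) (row-partner j) ⟩
        colOf (- - row j)         ≡⟨ cong colOf (ℤP.neg-involutive (row j)) ⟩
        colOf (entry i (toℕ j))   ≡⟨ colOf-entry i<r (FinP.toℕ<n j) ⟩
        toℕ j ∎)
      where open ≡-Reasoning

  rowSum≡0 : ∑< n (entry i) ≡ 0ℤ
  rowSum≡0 = x≡-x⇒x≡0 _ (begin
      ∑< n (entry i)                    ≡⟨ sym (ΣFin≡∑< n (entry i)) ⟩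
      ΣFin n row                        ≡⟨ ΣFin≡sum n row ⟩
      sum row                           ≡⟨ sum-permute row (permutation partner partner partner-involutive partner-involutive) ⟩
      sum (λ j → row (partner j))       ≡⟨ sum-cong-≗ row-partner ⟩
      sum (λ j → - row j)               ≡⟨ sym (ΣFin≡sum n (λ j → - row j)) ⟩
      ΣFin n (λ j → - entry i (toℕ j)) ≡⟨ ΣFin≡∑< n (λ j → - entry i j) ⟩
      ∑< n (λ j → - entry i j)          ≡⟨ ∑<-neg n (entry i) ⟩
      - ∑< n (entry i) ∎)
    where open ≡-Reasoning

block⇒SMA : ∀ {m n} (B : Block m n) → Block.bound B ≡ half m n → (∀ j → j < n → colSum B j ≡ 0ℤ) →
  ∃[ A ] (IsSMA m n A × PairsInSameRow m n A)
block⇒SMA {m} {n} B bound≡half colSum≡0 = A , isSMA , pairs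
  where
  open Block B
  A : Array m n
  A i j = entry (toℕ i) (toℕ j)
  toPM : ∀ {x} → InX m n x → InPM bound x
  toPM {x} (x≢0 , ∣x∣≤) = x≢0 , subst (∣ x ∣ ≤_) (sym bound≡half) ∣x∣≤
  fromPM : ∀ {x} → InPM bound x → InX m n x
  fromPM {x} (x≢0 , ∣x∣≤) = x≢0 , subst (∣ x ∣ ≤_) bound≡half ∣x∣≤
  rowFin : ∀ {x} → InPM bound x → Fin m
  rowFin x∈ = fromℕ< (rowOf< x∈)
  colFin : ∀ {x} → InPM bound x → Fin n
  colFin x∈ = fromℕ< (colOf< x∈)
  A-at : ∀ {x} (x∈ : InPM bound x) → A (rowFin x∈) (colFin x∈) ≡ x
  A-at x∈ = trans (cong₂ entry (FinP.toℕ-fromℕ< _) (FinP.toℕ-fromℕ< _)) (entry-at x∈)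

  isSMA : IsSMA m n A
  isSMA = record
    { entriesInX  = λ i j → fromPM (entry-InPM (FinP.toℕ<n i) (FinP.toℕ<n j))
    ; appearsOnce = λ x x∈ → rowFin (toPM x∈) , colFin (toPM x∈) , A-at (toPM x∈) , λ i' j' A≡x →
        FinP.toℕ-injective (trans (sym (rowOf-entry (FinP.toℕ<n i') (FinP.toℕ<n j')))
                                  (trans (cong rowOf A≡x) (sym (FinP.toℕ-fromℕ< _)))) ,
        FinP.toℕ-injective (trans (sym (colOf-entry (FinP.toℕ<n i') (FinP.toℕ<n j')))
                                  (trans (cong colOf A≡x) (sym (FinP.toℕ-fromℕ< _))))
    ; rowSums = λ i → trans (ΣFin≡∑< n (entry (toℕ i))) (rowSum≡0 B (FinP.toℕ<n i))
    ; colSums = λ j → trans (ΣFin≡∑< m (λ i → entry i (toℕ j))) (colSum≡0 (toℕ j) (FinP.toℕ<n j))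
    }

  pairs : PairsInSameRow m n A
  pairs (suc x) _ x≤ = rowFin x∈ , colFin x∈ , colFin (InPM-neg x∈) , A-at x∈ , (begin
      A (rowFin x∈) (colFin (InPM-neg x∈))        ≡⟨ cong (λ z → A z (colFin (InPM-neg x∈))) (FinP.toℕ-injective sameRow) ⟩
      A (rowFin (InPM-neg x∈)) (colFin (InPM-neg x∈)) ≡⟨ A-at (InPM-neg x∈) ⟩
      - + suc x ∎)
    where
    open ≡-Reasoning
    x∈ : InPM bound (+ suc x)
    x∈ = (λ ()) , subst (suc x ≤_) (sym bound≡half) x≤
    sameRow : toℕ (rowFin x∈) ≡ toℕ (rowFin (InPM-neg x∈))
    sameRow = begin
      toℕ (rowFin x∈)             ≡⟨ FinP.toℕ-fromℕ< _ ⟩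
      rowOf (+ suc x)             ≡⟨ rowOf-neg (rowOf< x∈) (colOf< x∈) ⟨
      rowOf (- entry (rowOf (+ suc x)) (colOf (+ suc x))) ≡⟨ cong (λ z → rowOf (- z)) (entry-at x∈) ⟩
      rowOf (- + suc x)           ≡⟨ FinP.toℕ-fromℕ< _ ⟨
      toℕ (rowFin (InPM-neg x∈)) ∎

injective⇒surjective : ∀ {n} (f : Fin n → Fin n) → Injective _≡_ _≡_ f → ∀ y → ∃ λ x → f x ≡ y
injective⇒surjective {zero}  f f-inj ()
injective⇒surjective {suc n} f f-inj y with FinP.any? (λ x → f x FinP.≟ y)
... | yes hit = hit
... | no  miss = ⊥-elim (ℕP.1+n≰n (FinP.injective⇒≤ {f = g} g-inj))
  where
  y≢f : ∀ x → y ≢ f x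
  y≢f x y≡fx = miss (x , sym y≡fx)
  g : Fin (suc n) → Fin n
  g x = Fin.punchOut (y≢f x)
  g-inj : Injective _≡_ _≡_ g
  g-inj eq = f-inj (FinP.punchOut-injective (y≢f _) (y≢f _) eq)

leftInverse⇒rightInverse : ∀ n (f g : ℕ → ℕ) → (∀ {j} → j < n → f j < n) → (∀ {v} → v < n → g v < n) →
  (∀ {j} → j < n → g (f j) ≡ j) → ∀ {v} → v < n → f (g v) ≡ v
leftInverse⇒rightInverse n f g f< g< gf≡id {v} v<n = begin
    f (g v)           ≡⟨ cong (λ z → f (g z)) (sym fx≡v) ⟩
    f (g (f (toℕ x))) ≡⟨ cong f (gf≡id (FinP.toℕ<n x)) ⟩
    f (toℕ x)         ≡⟨ fx≡v ⟩
    v ∎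
  where
  open ≡-Reasoning
  F : Fin n → Fin n
  F j = fromℕ< (f< (FinP.toℕ<n j))
  toℕ-F : ∀ j → toℕ (F j) ≡ f (toℕ j)
  toℕ-F j = FinP.toℕ-fromℕ< _
  F-inj : Injective _≡_ _≡_ F
  F-inj {a} {b} Fa≡Fb = FinP.toℕ-injective (begin
      toℕ a         ≡⟨ sym (gf≡id (FinP.toℕ<n a)) ⟩
      g (f (toℕ a)) ≡⟨ cong g (trans (sym (toℕ-F a)) (trans (cong toℕ Fa≡Fb) (toℕ-F b))) ⟩
      g (f (toℕ b)) ≡⟨ gf≡id (FinP.toℕ<n b) ⟩
      toℕ b ∎)
  x : Fin n
  x = proj₁ (injective⇒surjective F F-inj (fromℕ< v<n))
  fx≡v : f (toℕ x) ≡ v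
  fx≡v = trans (sym (toℕ-F x)) (trans (cong toℕ (proj₂ (injective⇒surjective F F-inj (fromℕ< v<n)))) (FinP.toℕ-fromℕ< _))

-- Reduced to leftInverse⇒rightInverse by shifting the values of f down by one.
rightInverse⇒leftInverse₁ : ∀ n (f g : ℕ → ℕ) → (∀ {j} → j < n → 1 ≤ f j × f j ≤ n) →
  (∀ {v} → 1 ≤ v → v ≤ n → g v < n × f (g v) ≡ v) → ∀ {j} → j < n → g (f j) ≡ j
rightInverse⇒leftInverse₁ n f g f∈ g-ok {j} j<n =
  trans (cong g (sym (suc-pred-f j<n)))
        (leftInverse⇒rightInverse n (λ v → g (suc v)) (λ j → ℕ.pred (f j)) g< pred-f< pred-fg j<n)
  where
  suc-pred-f : ∀ {j} → j < n → suc (ℕ.pred (f j)) ≡ f j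
  suc-pred-f j<n = ℕP.suc-pred (f _) {{ℕ.>-nonZero (proj₁ (f∈ j<n))}}
  g< : ∀ {v} → v < n → g (suc v) < n
  g< v<n = proj₁ (g-ok (s≤s z≤n) v<n)
  pred-f< : ∀ {j} → j < n → ℕ.pred (f j) < n
  pred-f< j<n = subst (_≤ n) (sym (suc-pred-f j<n)) (proj₂ (f∈ j<n))
  pred-fg : ∀ {v} → v < n → ℕ.pred (f (g (suc v))) ≡ v
  pred-fg v<n = cong ℕ.pred (proj₂ (g-ok (s≤s z≤n) v<n))

quot2 rem2 quot4 rem4 : ℕ → ℕ
quot2 (suc (suc j)) = suc (quot2 j)
quot2 _             = 0
rem2 (suc (suc j)) = rem2 j
rem2 j             = j
quot4 (suc (suc (suc (suc j)))) = suc (quot4 j)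
quot4 _                         = 0
rem4 (suc (suc (suc (suc j)))) = rem4 j
rem4 j                         = j

quot2-rem2 : ∀ e s → s < 2 → quot2 (e * 2 + s) ≡ e × rem2 (e * 2 + s) ≡ s
quot2-rem2 zero    0 _  = refl , refl
quot2-rem2 zero    1 _  = refl , refl
quot2-rem2 zero    (suc (suc s)) (s≤s (s≤s ()))
quot2-rem2 (suc e) s s<2 = cong suc (proj₁ (quot2-rem2 e s s<2)) , proj₂ (quot2-rem2 e s s<2)

quot4-rem4 : ∀ b r → r < 4 → quot4 (b * 4 + r) ≡ b × rem4 (b * 4 + r) ≡ r
quot4-rem4 zero    0 _  = refl , refl
quot4-rem4 zero    1 _  = refl , refl
quot4-rem4 zero    2 _  = refl , refl
quot4-rem4 zero    3 _  = refl , refl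
quot4-rem4 zero    (suc (suc (suc (suc r)))) (s≤s (s≤s (s≤s (s≤s ()))))
quot4-rem4 (suc b) r r<4 = cong suc (proj₁ (quot4-rem4 b r r<4)) , proj₂ (quot4-rem4 b r r<4)

elim2 : ∀ {P : ℕ → Set} → (∀ e → P (e * 2 + 0)) → (∀ e → P (e * 2 + 1)) → ∀ j → P j
elim2 p₀ p₁ zero          = p₀ 0
elim2 p₀ p₁ (suc zero)    = p₁ 0
elim2 {P} p₀ p₁ (suc (suc j)) = elim2 {λ k → P (suc (suc k))} (λ e → p₀ (suc e)) (λ e → p₁ (suc e)) j

elim4 : ∀ {P : ℕ → Set} → (∀ b → P (b * 4 + 0)) → (∀ b → P (b * 4 + 1)) →
        (∀ b → P (b * 4 + 2)) → (∀ b → P (b * 4 + 3)) → ∀ j → P j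
elim4 p₀ p₁ p₂ p₃ zero                   = p₀ 0
elim4 p₀ p₁ p₂ p₃ (suc zero)             = p₁ 0
elim4 p₀ p₁ p₂ p₃ (suc (suc zero))       = p₂ 0
elim4 p₀ p₁ p₂ p₃ (suc (suc (suc zero))) = p₃ 0
elim4 {P} p₀ p₁ p₂ p₃ (suc (suc (suc (suc j)))) =
  elim4 {λ k → P (suc (suc (suc (suc k))))} (λ b → p₀ (suc b)) (λ b → p₁ (suc b)) (λ b → p₂ (suc b)) (λ b → p₃ (suc b)) j

*2+<+⇒< : ∀ {e s t} → e * 2 + s < t + t → e < t
*2+<+⇒< {e} {s} {t} lt =
  ℕP.*-cancelʳ-< 2 e t (ℕP.≤-<-trans (ℕP.m≤m+n (e * 2) s) (subst (e * 2 + s <_) (t+t≡t*2 t) lt))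
  where t+t≡t*2 : ∀ t → t + t ≡ t * 2
        t+t≡t*2 = ℕ-solve

<⇒*2+1<+ : ∀ {e t} → e < t → e * 2 + 1 < t + t
<⇒*2+1<+ {e} {t} e<t = subst₂ _≤_ (eq₁ e) (eq₂ t) (ℕP.*-monoˡ-≤ 2 e<t)
  where eq₁ : ∀ e → suc e * 2 ≡ suc (e * 2 + 1)
        eq₁ = ℕ-solve
        eq₂ : ∀ t → t * 2 ≡ t + t
        eq₂ = ℕ-solve

-- Rows and two-row blocks

record Row (n K : ℕ) : Set where
  field
    at       : ℕ → ℤ
    colOf    : ℤ → ℕ
    at-InPM  : ∀ {j} → j < n → InPM K (at j)
    colOf<   : ∀ {x} → InPM K x → colOf x < n
    at-colOf : ∀ {x} → InPM K x → at (colOf x) ≡ x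
    colOf-at : ∀ {j} → j < n → colOf (at j) ≡ j

rowBlock : ∀ {n K} → Row n K → Block 1 n
rowBlock {n} {K} ρ = record
  { entry = λ _ j → at j ; bound = K ; rowOf = λ _ → 0 ; colOf = colOf
  ; entry-InPM = λ _ j< → at-InPM j< ; rowOf< = λ _ → s≤s z≤n ; colOf< = colOf<
  ; entry-at = at-colOf ; rowOf-entry = λ i<1 _ → 0≡ i<1 ; colOf-entry = λ _ j< → colOf-at j<
  ; rowOf-neg = λ i<1 _ → 0≡ i<1 }
  where
  open Row ρ
  0≡ : ∀ {i} → i < 1 → 0 ≡ i
  0≡ (s≤s z≤n) = refl

colSum-rowBlock : ∀ {n K} (ρ : Row n K) j → colSum (rowBlock ρ) j ≡ Row.at ρ j
colSum-rowBlock ρ j = ℤP.+-identityʳ _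

colSgnSum-rowBlock : ∀ {n K} (ρ : Row n K) j → colSgnSum (rowBlock ρ) j ≡ sgn (Row.at ρ j)
colSgnSum-rowBlock ρ j = ℤP.+-identityʳ _

negateRow : ∀ {n K} → Row n K → Row n K
negateRow ρ = record
  { at = λ j → - at j ; colOf = λ x → colOf (- x)
  ; at-InPM = λ j< → InPM-neg (at-InPM j<)
  ; colOf< = λ x∈ → colOf< (InPM-neg x∈)
  ; at-colOf = λ {x} x∈ → trans (cong -_ (at-colOf (InPM-neg x∈))) (ℤP.neg-involutive x)
  ; colOf-at = λ {j} j< → trans (cong colOf (ℤP.neg-involutive (at j))) (colOf-at j<) }
  where open Row ρ

permuteRow : ∀ {n K} → Row n K → (π : ℕ → ℕ) → (∀ {j} → j < n → π j < n) → (∀ {j} → j < n → π (π j) ≡ j) → Row n K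
permuteRow ρ π π< π-involutive = record
  { at = λ j → at (π j) ; colOf = λ x → π (colOf x)
  ; at-InPM = λ j< → at-InPM (π< j<)
  ; colOf< = λ x∈ → π< (colOf< x∈)
  ; at-colOf = λ x∈ → trans (cong at (π-involutive (colOf< x∈))) (at-colOf x∈)
  ; colOf-at = λ j< → trans (cong π (colOf-at (π< j<))) (π-involutive j<) }
  where open Row ρ

signedBy : ℕ → ℤ → ℤ
signedBy zero    x = x
signedBy (suc _) x = - x

InPM-signedBy : ∀ {K} s {v} → 1 ≤ v → v ≤ K → InPM K (signedBy s (+ v))
InPM-signedBy zero    {suc v} _ v≤K = (λ ()) , v≤K
InPM-signedBy (suc s) {suc v} _ v≤K = (λ ()) , v≤K

module StandardRow (t : ℕ) where
  at : ℕ → ℤ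
  at j = signedBy (rem2 j) (+ (t ∸ quot2 j))

  colOf : ℤ → ℕ
  colOf (+ zero)  = 0
  colOf +[1+ v ] = (t ∸ suc v) * 2 + 0
  colOf -[1+ v ] = (t ∸ suc v) * 2 + 1

  at-*2+ : ∀ e s → s < 2 → at (e * 2 + s) ≡ signedBy s (+ (t ∸ e))
  at-*2+ e s s<2 = cong₂ (λ a b → signedBy a (+ (t ∸ b))) (proj₂ (quot2-rem2 e s s<2)) (proj₁ (quot2-rem2 e s s<2))

  private
    at-InPM′ : ∀ e s → s < 2 → e * 2 + s < t + t → InPM t (at (e * 2 + s))
    at-InPM′ e s s<2 lt = subst (InPM t) (sym (at-*2+ e s s<2))
      (InPM-signedBy s (ℕP.m<n⇒0<n∸m (*2+<+⇒< {e} {s} lt)) (ℕP.m∸n≤m t e))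

    colOf-signedBy : ∀ s e → s < 2 → e < t → colOf (signedBy s (+ (t ∸ e))) ≡ e * 2 + s
    colOf-signedBy s e s<2 e<t with t ∸ e | ℕP.m∸[m∸n]≡n (ℕP.<⇒≤ e<t) | ℕP.m<n⇒0<n∸m e<t
    colOf-signedBy 0 e _ _ | suc w | t∸suc-w≡e | _ = cong (λ z → z * 2 + 0) t∸suc-w≡e
    colOf-signedBy 1 e _ _ | suc w | t∸suc-w≡e | _ = cong (λ z → z * 2 + 1) t∸suc-w≡e
    colOf-signedBy (suc (suc s)) e (s≤s (s≤s ())) _ | _ | _ | _

    colOf-at′ : ∀ e s → s < 2 → e * 2 + s < t + t → colOf (at (e * 2 + s)) ≡ e * 2 + s
    colOf-at′ e s s<2 lt = trans (cong colOf (at-*2+ e s s<2)) (colOf-signedBy s e s<2 (*2+<+⇒< {e} {s} lt))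

  at-InPM : ∀ {j} → j < t + t → InPM t (at j)
  at-InPM {j} = elim2 {λ j → j < t + t → InPM t (at j)} (λ e → at-InPM′ e 0 (s≤s z≤n)) (λ e → at-InPM′ e 1 (s≤s (s≤s z≤n))) j

  colOf< : ∀ {x} → InPM t x → colOf x < t + t
  colOf< {+[1+ v ]} (_ , v<t) = ℕP.<-trans (ℕP.+-monoʳ-< ((t ∸ suc v) * 2) (s≤s z≤n)) (<⇒*2+1<+ (ℕP.∸-monoʳ-< {t} {suc v} {0} (s≤s z≤n) v<t))
  colOf< { -[1+ v ]} (_ , v<t) = <⇒*2+1<+ (ℕP.∸-monoʳ-< {t} {suc v} {0} (s≤s z≤n) v<t)
  colOf< {+ zero} (x≢0 , _) = ⊥-elim (x≢0 refl)

  at-colOf : ∀ {x} → InPM t x → at (colOf x) ≡ x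
  at-colOf {+ zero}    (x≢0 , _) = ⊥-elim (x≢0 refl)
  at-colOf {+[1+ v ]} (_ , v<t) = trans (at-*2+ (t ∸ suc v) 0 (s≤s z≤n)) (cong +_ (ℕP.m∸[m∸n]≡n v<t))
  at-colOf { -[1+ v ]} (_ , v<t) = trans (at-*2+ (t ∸ suc v) 1 (s≤s (s≤s z≤n))) (cong (λ z → - (+ z)) (ℕP.m∸[m∸n]≡n v<t))

  colOf-at : ∀ {j} → j < t + t → colOf (at j) ≡ j
  colOf-at {j} = elim2 {λ j → j < t + t → colOf (at j) ≡ j} (λ e → colOf-at′ e 0 (s≤s z≤n)) (λ e → colOf-at′ e 1 (s≤s (s≤s z≤n))) j

  row : Row (t + t) t
  row = record { at = at ; colOf = colOf ; at-InPM = at-InPM ; colOf< = colOf< ; at-colOf = at-colOf ; colOf-at = colOf-at }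

-- Column j holds + pos j and - neg j; both +v and -v go to row colour v,
-- which forces the two entries of a column into different rows.
record TwoRowSpec (n : ℕ) : Set where
  field
    pos neg posCol negCol : ℕ → ℕ
    colour    : ℕ → Bool
    column-ok : ∀ {j} → j < n →
      (1 ≤ pos j × pos j ≤ n) × (1 ≤ neg j × neg j ≤ n) × colour (pos j) ≢ colour (neg j)
    posCol-ok : ∀ {v} → 1 ≤ v → v ≤ n → posCol v < n × pos (posCol v) ≡ v
    negCol-ok : ∀ {v} → 1 ≤ v → v ≤ n → negCol v < n × neg (negCol v) ≡ v

rowIndex : Bool → ℕ
rowIndex false = 0
rowIndex true  = 1

-- choose i b x y puts x in row rowIndex b and y in the other row.
choose : ℕ → Bool → ℤ → ℤ → ℤ
choose zero    false x y = x
choose zero    true  x y = y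
choose (suc _) false x y = y
choose (suc _) true  x y = x

choose-cases : ∀ i b x y → choose i b x y ≡ x ⊎ choose i b x y ≡ y
choose-cases zero    false x y = inj₁ refl
choose-cases zero    true  x y = inj₂ refl
choose-cases (suc i) false x y = inj₂ refl
choose-cases (suc i) true  x y = inj₁ refl

choose-own : ∀ b x y → choose (rowIndex b) b x y ≡ x
choose-own false x y = refl
choose-own true  x y = refl

choose-other : ∀ b c x y → b ≢ c → choose (rowIndex c) b x y ≡ y
choose-other false false x y b≢c = ⊥-elim (b≢c refl)
choose-other false true  x y _   = refl
choose-other true  false x y _   = refl
choose-other true  true  x y b≢c = ⊥-elim (b≢c refl)

choose-preserves : ∀ {A : Set} (g : ℤ → A) {a} i b x y → g x ≡ a → g y ≡ a → g (choose i b x y) ≡ a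
choose-preserves g i b x y gx≡a gy≡a with choose-cases i b x y
... | inj₁ eq = trans (cong g eq) gx≡a
... | inj₂ eq = trans (cong g eq) gy≡a

choose-closed : ∀ (P : ℤ → Set) i b x y → P x → P y → P (choose i b x y)
choose-closed P i b x y px py with choose-cases i b x y
... | inj₁ eq = subst P (sym eq) px
... | inj₂ eq = subst P (sym eq) py

choose-rowIndex : ∀ i b c (x y : ℤ) → i < 2 → b ≢ c → (g : ℤ → ℕ) →
  g x ≡ rowIndex b → g y ≡ rowIndex c → g (choose i b x y) ≡ i
choose-rowIndex 0 false false x y _ b≢c g _ _  = ⊥-elim (b≢c refl)
choose-rowIndex 0 false true  x y _ _   g gx _ = gx
choose-rowIndex 0 true  false x y _ _   g _ gy = gy
choose-rowIndex 0 true  true  x y _ b≢c g _ _  = ⊥-elim (b≢c refl)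
choose-rowIndex 1 false false x y _ b≢c g _ _  = ⊥-elim (b≢c refl)
choose-rowIndex 1 false true  x y _ _   g _ gy = gy
choose-rowIndex 1 true  false x y _ _   g gx _ = gx
choose-rowIndex 1 true  true  x y _ b≢c g _ _  = ⊥-elim (b≢c refl)
choose-rowIndex (suc (suc i)) _ _ _ _ (s≤s (s≤s ())) _ _ _ _

+≢0 : ∀ {v} → 1 ≤ v → + v ≢ 0ℤ
+≢0 {suc v} _ ()

module TwoRow {n} (S : TwoRowSpec n) where
  open TwoRowSpec S

  private
    pos∈ : ∀ {j} → j < n → 1 ≤ pos j × pos j ≤ n
    pos∈ j< = proj₁ (column-ok j<)
    neg∈ : ∀ {j} → j < n → 1 ≤ neg j × neg j ≤ n
    neg∈ j< = proj₁ (proj₂ (column-ok j<))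
    colour≢ : ∀ {j} → j < n → colour (pos j) ≢ colour (neg j)
    colour≢ j< = proj₂ (proj₂ (column-ok j<))

  entry : ℕ → ℕ → ℤ
  entry i j = choose i (colour (pos j)) (+ pos j) (- + neg j)

  rowOf : ℤ → ℕ
  rowOf x = rowIndex (colour ∣ x ∣)

  colOf : ℤ → ℕ
  colOf (+ v)     = posCol v
  colOf -[1+ v ] = negCol (suc v)

  private
    ∣-+v∣ : ∀ v → ∣ - (+ v) ∣ ≡ v
    ∣-+v∣ v = ℤP.∣-i∣≡∣i∣ (+ v)

    colOf-neg : ∀ {v} → 1 ≤ v → colOf (- (+ v)) ≡ negCol v
    colOf-neg {suc v} _ = refl

    posCol-pos : ∀ {j} → j < n → posCol (pos j) ≡ j
    posCol-pos = rightInverse⇒leftInverse₁ n pos posCol pos∈ posCol-ok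

    negCol-neg : ∀ {j} → j < n → negCol (neg j) ≡ j
    negCol-neg = rightInverse⇒leftInverse₁ n neg negCol neg∈ negCol-ok

    entry-InPM : ∀ {i j} → i < 2 → j < n → InPM n (entry i j)
    entry-InPM {i} {j} _ j< = choose-closed (InPM n) i (colour (pos j)) (+ pos j) (- + neg j)
      (+≢0 (proj₁ (pos∈ j<)) , proj₂ (pos∈ j<))
      (neg-≢0 (+≢0 (proj₁ (neg∈ j<))) , subst (_≤ n) (sym (∣-+v∣ (neg j))) (proj₂ (neg∈ j<)))

    rowOf< : ∀ {x} → InPM n x → rowOf x < 2
    rowOf< {x} _ with colour ∣ x ∣
    ... | false = s≤s z≤n
    ... | true  = s≤s (s≤s z≤n)

    colOf< : ∀ {x} → InPM n x → colOf x < n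
    colOf< {+ zero}    (x≢0 , _) = ⊥-elim (x≢0 refl)
    colOf< {+[1+ v ]} (_ , v<n) = proj₁ (posCol-ok (s≤s z≤n) v<n)
    colOf< { -[1+ v ]} (_ , v<n) = proj₁ (negCol-ok (s≤s z≤n) v<n)

    entry-at-pos : ∀ j v → pos j ≡ v → choose (rowIndex (colour v)) (colour (pos j)) (+ pos j) (- (+ neg j)) ≡ + v
    entry-at-pos j v refl = choose-own (colour v) _ _

    entry-at-neg : ∀ j v → j < n → neg j ≡ v → choose (rowIndex (colour v)) (colour (pos j)) (+ pos j) (- (+ neg j)) ≡ - (+ v)
    entry-at-neg j v j< refl = choose-other (colour (pos j)) (colour (neg j)) _ _ (colour≢ j<)

    entry-at : ∀ {x} → InPM n x → entry (rowOf x) (colOf x) ≡ x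
    entry-at {+ zero}    (x≢0 , _) = ⊥-elim (x≢0 refl)
    entry-at {+[1+ v ]} (_ , v<n) = entry-at-pos (posCol (suc v)) (suc v) (proj₂ (posCol-ok (s≤s z≤n) v<n))
    entry-at { -[1+ v ]} (_ , v<n) = entry-at-neg (negCol (suc v)) (suc v) (proj₁ (negCol-ok (s≤s z≤n) v<n)) (proj₂ (negCol-ok (s≤s z≤n) v<n))

    rowOf-entry : ∀ {i j} → i < 2 → j < n → rowOf (entry i j) ≡ i
    rowOf-entry {i} {j} i<2 j< = choose-rowIndex i (colour (pos j)) (colour (neg j)) (+ pos j) (- + neg j) i<2 (colour≢ j<)
      rowOf refl (cong (λ z → rowIndex (colour z)) (∣-+v∣ (neg j)))

    colOf-entry : ∀ {i j} → i < 2 → j < n → colOf (entry i j) ≡ j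
    colOf-entry {i} {j} _ j< = choose-preserves colOf i (colour (pos j)) (+ pos j) (- + neg j)
      (posCol-pos j<) (trans (colOf-neg (proj₁ (neg∈ j<))) (negCol-neg j<))

    rowOf-neg : ∀ {i j} → i < 2 → j < n → rowOf (- entry i j) ≡ i
    rowOf-neg {i} {j} i<2 j< = trans (cong (λ z → rowIndex (colour z)) (ℤP.∣-i∣≡∣i∣ (entry i j))) (rowOf-entry i<2 j<)

  block : Block 2 n
  block = record
    { entry = entry ; bound = n ; rowOf = rowOf ; colOf = colOf
    ; entry-InPM = entry-InPM ; rowOf< = rowOf< ; colOf< = colOf< ; entry-at = entry-at
    ; rowOf-entry = rowOf-entry ; colOf-entry = colOf-entry ; rowOf-neg = rowOf-neg }

  colSum-block : ∀ j → colSum block j ≡ + pos j -ℤ + neg j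
  colSum-block j with colour (pos j)
  ... | false = cong (+ pos j +ℤ_) (ℤP.+-identityʳ (- + neg j))
  ... | true  = trans (cong (- + neg j +ℤ_) (ℤP.+-identityʳ (+ pos j))) (ℤP.+-comm (- + neg j) (+ pos j))

  colSgnSum-block : ∀ {j} → j < n → colSgnSum block j ≡ 0ℤ
  colSgnSum-block {j} j< with pos j | neg j | pos∈ j< | neg∈ j<
  ... | suc p | suc _ | _ | _ with colour (suc p)
  ...   | false = refl
  ...   | true  = refl

infix 0 if_≤_then_else_
if_≤_then_else_ : {A : Set} → ℕ → ℕ → A → A → A
if a ≤ b then x else y with a ≤? b
... | yes _ = x
... | no  _ = y

if-≤ : ∀ {A : Set} {a b} {x y : A} → a ≤ b → (if a ≤ b then x else y) ≡ x
if-≤ {a = a} {b} a≤b with a ≤? b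
... | yes _  = refl
... | no a≰b = ⊥-elim (a≰b a≤b)

if-> : ∀ {A : Set} {a b} {x y : A} → b < a → (if a ≤ b then x else y) ≡ y
if-> {a = a} {b} b<a with a ≤? b
... | yes a≤b = ⊥-elim (ℕP.<⇒≱ b<a a≤b)
... | no _    = refl

elim4< : ∀ {n} {P : ℕ → Set} → (∀ b r → r < 4 → b * 4 + r < n → P (b * 4 + r)) → ∀ {j} → j < n → P j
elim4< {n} {P} p {j} = elim4 {λ j → j < n → P j}
  (λ b → p b 0 (s≤s z≤n)) (λ b → p b 1 (s≤s (s≤s z≤n)))
  (λ b → p b 2 (s≤s (s≤s (s≤s z≤n)))) (λ b → p b 3 (s≤s (s≤s (s≤s (s≤s z≤n))))) j

*4+<⇒< : ∀ {b r a} → b * 4 + r < a * 4 → b < a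
*4+<⇒< {b} {r} {a} lt = ℕP.*-cancelʳ-< 4 b a (ℕP.≤-<-trans (ℕP.m≤m+n (b * 4) r) lt)

suc[v∸1]≡v : ∀ {v} → 1 ≤ v → suc (v ∸ 1) ≡ v
suc[v∸1]≡v {suc v} _ = refl

∸-via : ∀ {a} b {c} → a ≡ b + c → a ∸ b ≡ c
∸-via {a} b {c} eq = trans (cong (_∸ b) eq) (ℕP.m+n∸m≡n b c)

∸suc<⇒ : ∀ {v a c} → suc a ≤ v → v ≤ a + c → v ∸ suc a < c
∸suc<⇒ {v} {a} {c} a<v v≤ = ℕP.+-cancelˡ-≤ a (suc (v ∸ suc a)) c (subst (_≤ a + c) eq v≤)
  where eq : v ≡ a + suc (v ∸ suc a)
        eq = trans (sym (ℕP.m+[n∸m]≡n a<v)) (sym (ℕP.+-suc a (v ∸ suc a)))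

+x+y-z≡0 : ∀ x y z → x + y ≡ z → + x +ℤ (+ y -ℤ + z) ≡ 0ℤ
+x+y-z≡0 x y z x+y≡z = trans (assoc (+ x) (+ y) (+ z))
  (trans (cong (_-ℤ + z) (trans (sym (ℤP.pos-+ x y)) (cong +_ x+y≡z))) (ℤP.+-inverseʳ (+ z)))
  where assoc : ∀ (X Y Z : ℤ) → X +ℤ (Y -ℤ Z) ≡ (X +ℤ Y) -ℤ Z
        assoc = solve-∀

-x+y-z≡0 : ∀ x y z → y ≡ x + z → - (+ x) +ℤ (+ y -ℤ + z) ≡ 0ℤ
-x+y-z≡0 x y z refl = trans (cong (λ w → - (+ x) +ℤ (w -ℤ + z)) (ℤP.pos-+ x z)) (cancel (+ x) (+ z))
  where cancel : ∀ (X Z : ℤ) → - X +ℤ ((X +ℤ Z) -ℤ Z) ≡ 0ℤ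
        cancel = solve-∀

false≢true-at : ∀ {a b : Bool} → a ≡ false → b ≡ true → a ≢ b
false≢true-at refl refl ()

true≢false-at : ∀ {a b : Bool} → a ≡ true → b ≡ false → a ≢ b
true≢false-at refl refl ()

-- Column identities of the three-row base; splitting t at its subtrahend clears the truncated subtractions.
column-identity₀ : ∀ t b → b * 2 ≤ t → (t ∸ b * 2) + suc b ≡ suc (t ∸ b)
column-identity₀ t b le with ℕP.m≤n⇒∃[o]m+o≡n le
... | c , refl = trans (cong (_+ suc b) (ℕP.m+n∸m≡n (b * 2) c)) (trans (eq₁ b c) (cong suc (sym (∸-via b (eq₂ b c)))))
  where eq₁ : ∀ b c → c + suc b ≡ suc (b + c)
        eq₁ = ℕ-solve
        eq₂ : ∀ b c → b * 2 + c ≡ b + (b + c)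
        eq₂ = ℕ-solve

column-identity₁ : ∀ t b → suc b * 2 ≤ t → (t + t) ∸ b ≡ (t ∸ suc b * 2) + suc (t + suc b)
column-identity₁ t b le with ℕP.m≤n⇒∃[o]m+o≡n le
... | c , refl = trans (∸-via b (eq b c)) (cong (_+ suc ((suc b * 2 + c) + suc b)) (sym (ℕP.m+n∸m≡n (suc b * 2) c)))
  where eq : ∀ b c → (suc b * 2 + c) + (suc b * 2 + c) ≡ b + (c + suc ((suc b * 2 + c) + suc b))
        eq = ℕ-solve

column-identity₂ : ∀ t b → b * 2 + 1 ≤ t → (t ∸ (b * 2 + 1)) + suc (t + b) ≡ (t + t) ∸ b
column-identity₂ t b le with ℕP.m≤n⇒∃[o]m+o≡n le
... | c , refl = trans (cong (_+ suc ((b * 2 + 1 + c) + b)) (ℕP.m+n∸m≡n (b * 2 + 1) c)) (sym (∸-via b (eq b c)))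
  where eq : ∀ b c → (b * 2 + 1 + c) + (b * 2 + 1 + c) ≡ b + (c + suc ((b * 2 + 1 + c) + b))
        eq = ℕ-solve

column-identity₃ : ∀ t b → b * 2 + 1 ≤ t → t ∸ b ≡ (t ∸ (b * 2 + 1)) + suc b
column-identity₃ t b le with ℕP.m≤n⇒∃[o]m+o≡n le
... | c , refl = trans (∸-via b (eq b c)) (cong (_+ suc b) (sym (ℕP.m+n∸m≡n (b * 2 + 1) c)))
  where eq : ∀ b c → b * 2 + 1 + c ≡ b + (c + suc b)
        eq = ℕ-solve

-- The three-row base: the standard row over a two-row block

-- With t = h + u, h = ⌈t/2⌉, column b * 4 + r holds (+ posVal b r, - negVal b r);
-- posVal b r - negVal b r is minus the standard row, so the column sums vanish.
module ThreeRow (h u : ℕ) (u≤h : u ≤ h) (h≤1+u : h ≤ suc u) (1≤h : 1 ≤ h) where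
  t : ℕ
  t = h + u

  posVal₁ negVal₁ : ℕ → ℕ
  posVal₁ zero    = suc (t + u)
  posVal₁ (suc b) = (t + t) ∸ b
  negVal₁ zero    = suc u
  negVal₁ (suc b) = suc (t + suc b)

  posVal negVal : ℕ → ℕ → ℕ
  posVal b 0 = suc b
  posVal b 1 = posVal₁ b
  posVal b 2 = suc (t + b)
  posVal b _ = t ∸ b
  negVal b 0 = suc (t ∸ b)
  negVal b 1 = negVal₁ b
  negVal b 2 = (t + t) ∸ b
  negVal b _ = suc b

  pos neg : ℕ → ℕ
  pos j = posVal (quot4 j) (rem4 j)
  neg j = negVal (quot4 j) (rem4 j)

  pos-*4+ : ∀ b r → r < 4 → pos (b * 4 + r) ≡ posVal b r
  pos-*4+ b r r<4 = cong₂ posVal (proj₁ (quot4-rem4 b r r<4)) (proj₂ (quot4-rem4 b r r<4))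

  neg-*4+ : ∀ b r → r < 4 → neg (b * 4 + r) ≡ negVal b r
  neg-*4+ b r r<4 = cong₂ negVal (proj₁ (quot4-rem4 b r r<4)) (proj₂ (quot4-rem4 b r r<4))

  posCol negCol : ℕ → ℕ
  posCol v = if v ≤ h then (v ∸ 1) * 4 + 0
             else if v ≤ t then (t ∸ v) * 4 + 3
             else if v ≤ t + u then (v ∸ suc t) * 4 + 2
             else if v ≤ suc (t + u) then 0 * 4 + 1
             else suc ((t + t) ∸ v) * 4 + 1
  negCol v = if v ≤ u then (v ∸ 1) * 4 + 3
             else if v ≤ suc u then 0 * 4 + 1
             else if v ≤ suc t then (suc t ∸ v) * 4 + 0
             else if v ≤ t + h then (v ∸ suc t) * 4 + 1
             else ((t + t) ∸ v) * 4 + 2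

  colour : ℕ → Bool
  colour v = if v ≤ h then false else if v ≤ t + h then true else false

  1≤t : 1 ≤ t
  1≤t = ℕP.≤-trans 1≤h (ℕP.m≤m+n h u)
  h≤t : h ≤ t
  h≤t = ℕP.m≤m+n h u
  u<t : u < t
  u<t = subst (u <_) (ℕP.+-comm u h) (ℕP.m<m+n u 1≤h)
  t<t+t : t < t + t
  t<t+t = ℕP.m<m+n t 1≤t
  t+h≤t+t : t + h ≤ t + t
  t+h≤t+t = ℕP.+-monoʳ-≤ t h≤t

  quot<h : ∀ b r → b * 4 + r < t + t → b < h
  quot<h b r lt = *4+<⇒< (ℕP.<-≤-trans lt t+t≤h*4)
    where t+t≤h*4 : t + t ≤ h * 4
          t+t≤h*4 = ℕP.≤-trans (ℕP.+-mono-≤ (ℕP.+-monoʳ-≤ h u≤h) (ℕP.+-monoʳ-≤ h u≤h)) (ℕP.≤-reflexive (eq h))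
            where eq : ∀ h → (h + h) + (h + h) ≡ h * 4
                  eq = ℕ-solve

  quot<u : ∀ b r → 2 ≤ r → b * 4 + r < t + t → b < u
  quot<u b r 2≤r lt = *4+<⇒< {r = 0} (ℕP.+-cancelʳ-< 2 (b * 4 + 0) (u * 4) (ℕP.≤-<-trans b*4+2≤ (ℕP.<-≤-trans lt t+t≤)))
    where b*4+2≤ : (b * 4 + 0) + 2 ≤ b * 4 + r
          b*4+2≤ = subst (_≤ b * 4 + r) (eq b) (ℕP.+-monoʳ-≤ (b * 4) 2≤r)
            where eq : ∀ b → b * 4 + 2 ≡ (b * 4 + 0) + 2
                  eq = ℕ-solve
          t+t≤ : t + t ≤ u * 4 + 2
          t+t≤ = ℕP.≤-trans (ℕP.+-mono-≤ (ℕP.+-monoˡ-≤ u h≤1+u) (ℕP.+-monoˡ-≤ u h≤1+u)) (ℕP.≤-reflexive (eq u))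
            where eq : ∀ u → (suc u + u) + (suc u + u) ≡ u * 4 + 2
                  eq = ℕ-solve

  *4+1<t+t : ∀ {x} → x < h → x * 4 + 1 < t + t
  *4+1<t+t {x} x<h = ℕP.≤-trans (ℕP.≤-reflexive (eq x)) (ℕP.+-mono-≤ (ℕP.+-mono-≤ x<h x≤u) (ℕP.+-mono-≤ x<h x≤u))
    where eq : ∀ x → suc (x * 4 + 1) ≡ (suc x + x) + (suc x + x)
          eq = ℕ-solve
          x≤u : x ≤ u
          x≤u = ℕP.≤-pred (ℕP.≤-trans x<h h≤1+u)

  *4+0<t+t : ∀ {x} → x < h → x * 4 + 0 < t + t
  *4+0<t+t {x} x<h = ℕP.<-trans (ℕP.+-monoʳ-< (x * 4) (s≤s z≤n)) (*4+1<t+t x<h)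

  *4+3<t+t : ∀ {x} → x < u → x * 4 + 3 < t + t
  *4+3<t+t {x} x<u = ℕP.≤-trans (ℕP.≤-reflexive (eq x))
    (ℕP.+-mono-≤ (ℕP.+-mono-≤ (ℕP.≤-trans x<u u≤h) x<u) (ℕP.+-mono-≤ (ℕP.≤-trans x<u u≤h) x<u))
    where eq : ∀ x → suc (x * 4 + 3) ≡ (suc x + suc x) + (suc x + suc x)
          eq = ℕ-solve

  *4+2<t+t : ∀ {x} → x < u → x * 4 + 2 < t + t
  *4+2<t+t {x} x<u = ℕP.<-trans (ℕP.+-monoʳ-< (x * 4) (s≤s (s≤s (s≤s z≤n)))) (*4+3<t+t x<u)

  PosColOk NegColOk : ℕ → Set
  PosColOk v = posCol v < t + t × pos (posCol v) ≡ v
  NegColOk v = negCol v < t + t × neg (negCol v) ≡ v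

  private
    posColAt : ∀ {v} b r → posCol v ≡ b * 4 + r → r < 4 → b * 4 + r < t + t → posVal b r ≡ v → PosColOk v
    posColAt b r eq r<4 lt val = subst (_< t + t) (sym eq) lt , trans (cong pos eq) (trans (pos-*4+ b r r<4) val)

    negColAt : ∀ {v} b r → negCol v ≡ b * 4 + r → r < 4 → b * 4 + r < t + t → negVal b r ≡ v → NegColOk v
    negColAt b r eq r<4 lt val = subst (_< t + t) (sym eq) lt , trans (cong neg eq) (trans (neg-*4+ b r r<4) val)

  posCol-ok : ∀ {v} → 1 ≤ v → v ≤ t + t → PosColOk v
  posCol-ok {v} 1≤v v≤t+t with ℕP.≤-<-connex v h
  ... | inj₁ v≤h = posColAt (v ∸ 1) 0 (if-≤ v≤h) (s≤s z≤n) (*4+0<t+t v∸1<h) (suc[v∸1]≡v 1≤v)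
    where v∸1<h = subst (_≤ h) (sym (suc[v∸1]≡v 1≤v)) v≤h
  ... | inj₂ h<v with ℕP.≤-<-connex v t
  ...   | inj₁ v≤t = posColAt (t ∸ v) 3 (trans (if-> h<v) (if-≤ v≤t)) (s≤s (s≤s (s≤s (s≤s z≤n))))
                       (*4+3<t+t t∸v<u) (ℕP.m∸[m∸n]≡n v≤t)
    where t∸v<u = subst (t ∸ v <_) (ℕP.m+n∸m≡n h u) (ℕP.∸-monoʳ-< {t} {v} {h} h<v v≤t)
  ...   | inj₂ t<v with ℕP.≤-<-connex v (t + u)
  ...     | inj₁ v≤t+u = posColAt (v ∸ suc t) 2 (trans (if-> h<v) (trans (if-> t<v) (if-≤ v≤t+u))) (s≤s (s≤s (s≤s z≤n)))
                           (*4+2<t+t (∸suc<⇒ t<v v≤t+u)) (ℕP.m+[n∸m]≡n t<v)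
  ...     | inj₂ t+u<v with ℕP.≤-<-connex v (suc (t + u))
  ...       | inj₁ v≤1+t+u = posColAt 0 1 (trans (if-> h<v) (trans (if-> t<v) (trans (if-> t+u<v) (if-≤ v≤1+t+u))))
                               (s≤s (s≤s z≤n)) (ℕP.<-≤-trans (s≤s 1≤t) t<t+t) (ℕP.≤-antisym t+u<v v≤1+t+u)
  ...       | inj₂ 1+t+u<v = posColAt (suc ((t + t) ∸ v)) 1 (trans (if-> h<v) (trans (if-> t<v) (trans (if-> t+u<v) (if-> 1+t+u<v))))
                               (s≤s (s≤s z≤n)) (*4+1<t+t 1+[t+t∸v]<h) (ℕP.m∸[m∸n]≡n v≤t+t)
    where
    t+t∸1+t+u≡h∸1 : (t + t) ∸ suc (t + u) ≡ h ∸ 1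
    t+t∸1+t+u≡h∸1 = ∸-via (suc (t + u)) (eq h u 1≤h)
      where eq : ∀ h u → 1 ≤ h → (h + u) + (h + u) ≡ suc ((h + u) + u) + (h ∸ 1)
            eq (suc h) u _ = eq′ h u
              where eq′ : ∀ h u → (suc h + u) + (suc h + u) ≡ suc ((suc h + u) + u) + h
                    eq′ = ℕ-solve
    1+[t+t∸v]<h : suc ((t + t) ∸ v) < h
    1+[t+t∸v]<h = subst (suc (suc ((t + t) ∸ v)) ≤_) (suc[v∸1]≡v 1≤h)
      (s≤s (subst ((t + t) ∸ v <_) t+t∸1+t+u≡h∸1 (ℕP.∸-monoʳ-< {t + t} {v} {suc (t + u)} 1+t+u<v v≤t+t)))

  negCol-ok : ∀ {v} → 1 ≤ v → v ≤ t + t → NegColOk v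
  negCol-ok {v} 1≤v v≤t+t with ℕP.≤-<-connex v u
  ... | inj₁ v≤u = negColAt (v ∸ 1) 3 (if-≤ v≤u) (s≤s (s≤s (s≤s (s≤s z≤n)))) (*4+3<t+t v∸1<u) (suc[v∸1]≡v 1≤v)
    where v∸1<u = subst (_≤ u) (sym (suc[v∸1]≡v 1≤v)) v≤u
  ... | inj₂ u<v with ℕP.≤-<-connex v (suc u)
  ...   | inj₁ v≤1+u = negColAt 0 1 (trans (if-> u<v) (if-≤ v≤1+u)) (s≤s (s≤s z≤n))
                         (ℕP.<-≤-trans (s≤s 1≤t) t<t+t) (ℕP.≤-antisym u<v v≤1+u)
  ...   | inj₂ 1+u<v with ℕP.≤-<-connex v (suc t)
  ...     | inj₁ v≤1+t = negColAt (suc t ∸ v) 0 (trans (if-> u<v) (trans (if-> 1+u<v) (if-≤ v≤1+t))) (s≤s z≤n)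
                           (*4+0<t+t 1+t∸v<h) (negVal₀≡ v 1≤v v≤1+t)
    where
    1+t∸v<h : suc t ∸ v < h
    1+t∸v<h = subst (suc t ∸ v <_) (ℕP.m+n∸n≡m h u) (ℕP.∸-monoʳ-< {suc t} {v} {suc u} 1+u<v v≤1+t)
    negVal₀≡ : ∀ v → 1 ≤ v → v ≤ suc t → negVal (suc t ∸ v) 0 ≡ v
    negVal₀≡ (suc v) _ (s≤s v≤t) = cong suc (ℕP.m∸[m∸n]≡n v≤t)
  ...     | inj₂ 1+t<v with ℕP.≤-<-connex v (t + h)
  ...       | inj₁ v≤t+h = negColAt (v ∸ suc t) 1 (trans (if-> u<v) (trans (if-> 1+u<v) (trans (if-> 1+t<v) (if-≤ v≤t+h))))
                             (s≤s (s≤s z≤n)) (*4+1<t+t (∸suc<⇒ (ℕP.<⇒≤ 1+t<v) v≤t+h))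
                             (trans (negVal₁-pos (ℕP.m<n⇒0<n∸m 1+t<v)) (ℕP.m+[n∸m]≡n (ℕP.<⇒≤ 1+t<v)))
    where
    negVal₁-pos : ∀ {b} → 1 ≤ b → negVal₁ b ≡ suc (t + b)
    negVal₁-pos {suc b} _ = refl
  ...       | inj₂ t+h<v = negColAt ((t + t) ∸ v) 2 (trans (if-> u<v) (trans (if-> 1+u<v) (trans (if-> 1+t<v) (if-> t+h<v))))
                             (s≤s (s≤s (s≤s z≤n))) (*4+2<t+t t+t∸v<u) (ℕP.m∸[m∸n]≡n v≤t+t)
    where
    t+t∸t+h≡u : (t + t) ∸ (t + h) ≡ u
    t+t∸t+h≡u = trans (cong (_∸ (t + h)) (sym (ℕP.+-assoc t h u))) (ℕP.m+n∸m≡n (t + h) u)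
    t+t∸v<u : (t + t) ∸ v < u
    t+t∸v<u = subst ((t + t) ∸ v <_) t+t∸t+h≡u (ℕP.∸-monoʳ-< {t + t} {v} {t + h} t+h<v v≤t+t)

  colour-≤h : ∀ {v} → v ≤ h → colour v ≡ false
  colour-≤h v≤h = if-≤ v≤h

  colour-mid : ∀ {v} → h < v → v ≤ t + h → colour v ≡ true
  colour-mid h<v v≤t+h = trans (if-> h<v) (if-≤ v≤t+h)

  colour-> : ∀ {v} → t + h < v → colour v ≡ false
  colour-> {v} t+h<v = trans (if-> (ℕP.≤-<-trans (ℕP.m≤n+m h t) t+h<v)) (if-> t+h<v)

  t+h<t+t∸ : ∀ {b} → b < u → t + h < (t + t) ∸ b
  t+h<t+t∸ {b} b<u = ℕP.m+n≤o⇒m≤o∸n (suc (t + h)) (subst (_≤ t + t) (sym (eq h u b)) (ℕP.+-monoʳ-≤ t (ℕP.+-monoʳ-≤ h b<u)))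
    where eq : ∀ h u b → suc ((h + u) + h) + b ≡ (h + u) + (h + suc b)
          eq = ℕ-solve

  ColumnOk : ℕ → ℕ → Set
  ColumnOk x y = (1 ≤ x × x ≤ t + t) × (1 ≤ y × y ≤ t + t) × colour x ≢ colour y

  columnOk₀ : ∀ {b} → b < h → ColumnOk (suc b) (suc (t ∸ b))
  columnOk₀ {b} b<h =
    (s≤s z≤n , ℕP.≤-trans b<h (ℕP.≤-trans h≤t (ℕP.m≤m+n t t))) , (s≤s z≤n , ℕP.≤-trans 1+t∸b≤1+t t<t+t) ,
    false≢true-at (colour-≤h b<h) (colour-mid (s≤s h≤t∸b) (ℕP.≤-trans 1+t∸b≤1+t (subst (_≤ t + h) (ℕP.+-comm t 1) (ℕP.+-monoʳ-≤ t 1≤h))))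
    where
    1+t∸b≤1+t : suc (t ∸ b) ≤ suc t
    1+t∸b≤1+t = s≤s (ℕP.m∸n≤m t b)
    h≤t∸b : h ≤ t ∸ b
    h≤t∸b = ℕP.m+n≤o⇒m≤o∸n h (ℕP.+-monoʳ-≤ h (ℕP.≤-pred (ℕP.≤-trans b<h h≤1+u)))

  columnOk₁-first : ColumnOk (suc (t + u)) (suc u)
  columnOk₁-first with ℕP.≤-<-connex h u
  ... | inj₁ h≤u = (s≤s z≤n , ℕP.+-monoʳ-< t u<t) , (s≤s z≤n , ℕP.≤-trans u<t (ℕP.m≤m+n t t)) ,
        false≢true-at (colour-> (s≤s (ℕP.+-monoʳ-≤ t h≤u))) (colour-mid (s≤s h≤u) (ℕP.≤-trans u<t (ℕP.m≤m+n t h)))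
  ... | inj₂ u<h = (s≤s z≤n , ℕP.+-monoʳ-< t u<t) , (s≤s z≤n , ℕP.≤-trans u<t (ℕP.m≤m+n t t)) ,
        true≢false-at (colour-mid (s≤s (ℕP.≤-trans h≤t (ℕP.m≤m+n t u))) (ℕP.+-monoʳ-< t u<h)) (colour-≤h u<h)

  columnOk₁ : ∀ {b} → suc b < h → ColumnOk ((t + t) ∸ b) (suc (t + suc b))
  columnOk₁ {b} 1+b<h =
    (ℕP.m<n⇒0<n∸m b<t+t , ℕP.m∸n≤m (t + t) b) , (s≤s z≤n , ℕP.≤-trans negVal≤t+h t+h≤t+t) ,
    false≢true-at (colour-> (t+h<t+t∸ b<u)) (colour-mid (s≤s (ℕP.≤-trans h≤t (ℕP.m≤m+n t (suc b)))) negVal≤t+h)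
    where
    b<u : b < u
    b<u = ℕP.≤-pred (ℕP.≤-trans 1+b<h h≤1+u)
    b<t+t : b < t + t
    b<t+t = ℕP.<-trans (ℕP.<-trans b<u u<t) t<t+t
    negVal≤t+h : suc (t + suc b) ≤ t + h
    negVal≤t+h = subst (_≤ t + h) (ℕP.+-suc t (suc b)) (ℕP.+-monoʳ-≤ t 1+b<h)

  columnOk₂ : ∀ {b} → b < u → ColumnOk (suc (t + b)) ((t + t) ∸ b)
  columnOk₂ {b} b<u =
    (s≤s z≤n , ℕP.+-monoʳ-< t b<t) , (ℕP.m<n⇒0<n∸m (ℕP.<-trans b<t t<t+t) , ℕP.m∸n≤m (t + t) b) ,
    true≢false-at (colour-mid (s≤s (ℕP.≤-trans h≤t (ℕP.m≤m+n t b))) (ℕP.+-monoʳ-< t (ℕP.<-≤-trans b<u u≤h)))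
                  (colour-> (t+h<t+t∸ b<u))
    where
    b<t : b < t
    b<t = ℕP.<-trans b<u u<t

  columnOk₃ : ∀ {b} → b < u → ColumnOk (t ∸ b) (suc b)
  columnOk₃ {b} b<u =
    (ℕP.m<n⇒0<n∸m b<t , ℕP.≤-trans (ℕP.m∸n≤m t b) (ℕP.m≤m+n t t)) , (s≤s z≤n , ℕP.≤-trans b<u (ℕP.≤-trans (ℕP.<⇒≤ u<t) (ℕP.m≤m+n t t))) ,
    true≢false-at (colour-mid h<t∸b (ℕP.≤-trans (ℕP.m∸n≤m t b) (ℕP.m≤m+n t h))) (colour-≤h (ℕP.≤-trans b<u u≤h))
    where
    b<t : b < t
    b<t = ℕP.<-trans b<u u<t
    h<t∸b : h < t ∸ b
    h<t∸b = ℕP.m+n≤o⇒m≤o∸n (suc h) (subst (_≤ t) (ℕP.+-suc h b) (ℕP.+-monoʳ-≤ h b<u))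

  private
    columnOk′ : ∀ b r → r < 4 → b * 4 + r < t + t → ColumnOk (posVal b r) (negVal b r)
    columnOk′ b       0 _ lt = columnOk₀ (quot<h b 0 lt)
    columnOk′ zero    1 _ _  = columnOk₁-first
    columnOk′ (suc b) 1 _ lt = columnOk₁ (quot<h (suc b) 1 lt)
    columnOk′ b       2 _ lt = columnOk₂ (quot<u b 2 (s≤s (s≤s z≤n)) lt)
    columnOk′ b       3 _ lt = columnOk₃ (quot<u b 3 (s≤s (s≤s z≤n)) lt)
    columnOk′ b (suc (suc (suc (suc r)))) (s≤s (s≤s (s≤s (s≤s ())))) _

  column-ok : ∀ {j} → j < t + t → ColumnOk (pos j) (neg j)
  column-ok = elim4< {P = λ j → ColumnOk (pos j) (neg j)} λ b r r<4 lt → subst₂ ColumnOk (sym (pos-*4+ b r r<4)) (sym (neg-*4+ b r r<4)) (columnOk′ b r r<4 lt)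

  spec : TwoRowSpec (t + t)
  spec = record
    { pos = pos ; neg = neg ; posCol = posCol ; negCol = negCol ; colour = colour
    ; column-ok = column-ok ; posCol-ok = posCol-ok ; negCol-ok = negCol-ok }

  open StandardRow t using () renaming (at to ρ; at-*2+ to ρ-*2+)

  private
    ρ-*4+ : ∀ b r e s → s < 2 → b * 4 + r ≡ e * 2 + s → ρ (b * 4 + r) ≡ signedBy s (+ (t ∸ e))
    ρ-*4+ b r e s s<2 eq = trans (cong ρ eq) (ρ-*2+ e s s<2)

    b*2≤t : ∀ b → b < h → b * 2 ≤ t
    b*2≤t b b<h = subst (_≤ t) (eq b) (ℕP.+-mono-≤ (ℕP.<⇒≤ b<h) (ℕP.≤-pred (ℕP.≤-trans b<h h≤1+u)))
      where eq : ∀ b → b + b ≡ b * 2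
            eq = ℕ-solve

    b*2+1≤t : ∀ b → b < u → b * 2 + 1 ≤ t
    b*2+1≤t b b<u = subst (_≤ t) (eq b) (ℕP.+-mono-≤ (ℕP.≤-trans b<u u≤h) (ℕP.<⇒≤ b<u))
      where eq : ∀ b → suc b + b ≡ b * 2 + 1
            eq = ℕ-solve

    viaRow : ∀ b r {x} → ρ (b * 4 + r) ≡ x → x +ℤ (+ posVal b r -ℤ + negVal b r) ≡ 0ℤ →
             ρ (b * 4 + r) +ℤ (+ posVal b r -ℤ + negVal b r) ≡ 0ℤ
    viaRow b r ρ≡x sum≡0 = trans (cong (_+ℤ (+ posVal b r -ℤ + negVal b r)) ρ≡x) sum≡0

    zeroColumn′ : ∀ b r → r < 4 → b * 4 + r < t + t → ρ (b * 4 + r) +ℤ (+ posVal b r -ℤ + negVal b r) ≡ 0ℤ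
    zeroColumn′ b 0 _ lt = viaRow b 0 (ρ-*4+ b 0 (b * 2) 0 (s≤s z≤n) (eq b))
      (+x+y-z≡0 (t ∸ b * 2) (suc b) (suc (t ∸ b)) (column-identity₀ t b (b*2≤t b (quot<h b 0 lt))))
      where eq : ∀ b → b * 4 + 0 ≡ b * 2 * 2 + 0
            eq = ℕ-solve
    zeroColumn′ zero 1 _ _ = -x+y-z≡0 t (suc (t + u)) (suc u) (sym (ℕP.+-suc t u))
    zeroColumn′ (suc b) 1 _ lt = viaRow (suc b) 1 (ρ-*4+ (suc b) 1 (suc b * 2) 1 (s≤s (s≤s z≤n)) (eq b))
      (-x+y-z≡0 (t ∸ suc b * 2) ((t + t) ∸ b) (suc (t + suc b)) (column-identity₁ t b (b*2≤t (suc b) (quot<h (suc b) 1 lt))))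
      where eq : ∀ b → suc b * 4 + 1 ≡ suc b * 2 * 2 + 1
            eq = ℕ-solve
    zeroColumn′ b 2 _ lt = viaRow b 2 (ρ-*4+ b 2 (b * 2 + 1) 0 (s≤s z≤n) (eq b))
      (+x+y-z≡0 (t ∸ (b * 2 + 1)) (suc (t + b)) ((t + t) ∸ b) (column-identity₂ t b (b*2+1≤t b (quot<u b 2 (s≤s (s≤s z≤n)) lt))))
      where eq : ∀ b → b * 4 + 2 ≡ (b * 2 + 1) * 2 + 0
            eq = ℕ-solve
    zeroColumn′ b 3 _ lt = viaRow b 3 (ρ-*4+ b 3 (b * 2 + 1) 1 (s≤s (s≤s z≤n)) (eq b))
      (-x+y-z≡0 (t ∸ (b * 2 + 1)) (t ∸ b) (suc b) (column-identity₃ t b (b*2+1≤t b (quot<u b 3 (s≤s (s≤s z≤n)) lt))))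
      where eq : ∀ b → b * 4 + 3 ≡ (b * 2 + 1) * 2 + 1
            eq = ℕ-solve
    zeroColumn′ b (suc (suc (suc (suc r)))) (s≤s (s≤s (s≤s (s≤s ())))) _

  zeroColumn : ∀ {j} → j < t + t → ρ j +ℤ (+ pos j -ℤ + neg j) ≡ 0ℤ
  zeroColumn = elim4< {P = λ j → ρ j +ℤ (+ pos j -ℤ + neg j) ≡ 0ℤ} λ b r r<4 lt →
    subst₂ (λ x y → ρ (b * 4 + r) +ℤ (+ x -ℤ + y) ≡ 0ℤ) (sym (pos-*4+ b r r<4)) (sym (neg-*4+ b r r<4)) (zeroColumn′ b r r<4 lt)

-- Balancing patterns

quot2-+ : ∀ h o → quot2 ((h + h) + o) ≡ h + quot2 o
quot2-+ zero    o = refl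
quot2-+ (suc h) o rewrite ℕP.+-suc h h = cong suc (quot2-+ h o)

rem2-+ : ∀ h o → rem2 ((h + h) + o) ≡ rem2 o
rem2-+ zero    o = refl
rem2-+ (suc h) o rewrite ℕP.+-suc h h = rem2-+ h o

<+⇒quot2< : ∀ {h j} → j < h + h → quot2 j < h
<+⇒quot2< {h} {j} = elim2 {λ j → j < h + h → quot2 j < h}
  (λ e lt → subst (_< h) (sym (proj₁ (quot2-rem2 e 0 (s≤s z≤n)))) (*2+<+⇒< {e} {0} lt))
  (λ e lt → subst (_< h) (sym (proj₁ (quot2-rem2 e 1 (s≤s (s≤s z≤n))))) (*2+<+⇒< {e} {1} lt)) j

signedBy-+ : ∀ s a b → signedBy s (+ (a + b)) ≡ signedBy s (+ a) +ℤ signedBy s (+ b)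
signedBy-+ zero    a b = ℤP.pos-+ a b
signedBy-+ (suc s) a b = trans (cong -_ (ℤP.pos-+ a b)) (ℤP.neg-distrib-+ (+ a) (+ b))

standardRow-+ˡ : ∀ h₁ h₂ {j} → j < h₁ + h₁ →
  StandardRow.at (h₁ + h₂) j ≡ StandardRow.at h₁ j +ℤ signedBy (rem2 j) (+ h₂)
standardRow-+ˡ h₁ h₂ {j} j< = trans (cong (λ z → signedBy (rem2 j) (+ z)) (ℕP.+-∸-comm h₂ (ℕP.<⇒≤ (<+⇒quot2< j<))))
  (signedBy-+ (rem2 j) (h₁ ∸ quot2 j) h₂)

standardRow-+ʳ : ∀ h₁ h₂ o → StandardRow.at (h₁ + h₂) ((h₁ + h₁) + o) ≡ StandardRow.at h₂ o
standardRow-+ʳ h₁ h₂ o = trans (cong₂ (λ s q → signedBy s (+ ((h₁ + h₂) ∸ q))) (rem2-+ h₁ o) (quot2-+ h₁ o))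
  (cong (λ z → signedBy (rem2 o) (+ z)) (ℕP.[m+n]∸[m+o]≡n∸o h₁ h₂ (quot2 o)))

record Pattern (w h : ℕ) : Set where
  field
    width≡    : w ≡ h + h
    spec      : TwoRowSpec w
    swap      : ℕ → ℕ
    swap-ok   : ∀ {j} → j < w → swap j < w × swap (swap j) ≡ j
  open TwoRowSpec spec public
  field
    balance   : ∀ {j} → j < w → StandardRow.at h (swap j) +ℤ (+ pos j -ℤ + neg j) ≡ StandardRow.at h j

SwapKeepsParity : ∀ {w h} → Pattern w h → Set
SwapKeepsParity {w} p = ∀ {j} → j < w → rem2 (Pattern.swap p j) ≡ rem2 j

splitCol : {A : Set} → ℕ → (ℕ → A) → (ℕ → A) → ℕ → A
splitCol L f g j = if suc j ≤ L then f j else g (j ∸ L)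

splitCol-< : ∀ {A : Set} L (f g : ℕ → A) {j} → j < L → splitCol L f g j ≡ f j
splitCol-< L f g j<L = if-≤ j<L

splitCol-+ : ∀ {A : Set} L (f g : ℕ → A) o → splitCol L f g (L + o) ≡ g o
splitCol-+ L f g o = trans (if-> (s≤s (ℕP.m≤m+n L o))) (cong g (ℕP.m+n∸m≡n L o))

splitVal : {A : Set} → ℕ → (ℕ → A) → (ℕ → A) → ℕ → A
splitVal L f g v = if v ≤ L then f v else g (v ∸ L)

splitVal-≤ : ∀ {A : Set} L (f g : ℕ → A) {v} → v ≤ L → splitVal L f g v ≡ f v
splitVal-≤ L f g v≤L = if-≤ v≤L

splitVal-+ : ∀ {A : Set} L (f g : ℕ → A) {x} → 1 ≤ x → splitVal L f g (L + x) ≡ g x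
splitVal-+ L f g {x} 1≤x = trans (if-> (ℕP.m<m+n L 1≤x)) (cong g (ℕP.m+n∸m≡n L x))

data ValView (L : ℕ) : ℕ → Set where
  low  : ∀ {v} → v ≤ L → ValView L v
  high : ∀ x → 1 ≤ x → ValView L (L + x)

valView : ∀ L v → ValView L v
valView L v with ℕP.≤-<-connex v L
... | inj₁ v≤L = low v≤L
... | inj₂ L<v = subst (ValView L) (ℕP.m+[n∸m]≡n (ℕP.<⇒≤ L<v)) (high (v ∸ L) (ℕP.m<n⇒0<n∸m L<v))

-- Only the first pattern meets a widened standard row, so only its swap must keep column parities.
module Concat {w₁ h₁ w₂ h₂} (p₁ : Pattern w₁ h₁) (parity₁ : SwapKeepsParity p₁) (p₂ : Pattern w₂ h₂) where
  private
    module P₁ = Pattern p₁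
    module P₂ = Pattern p₂
    shifted : (ℕ → ℕ) → ℕ → ℕ
    shifted f x = w₁ + f x
    w₁≤ : w₁ ≤ w₁ + w₂
    w₁≤ = ℕP.m≤m+n w₁ w₂

  pos neg swap posCol negCol : ℕ → ℕ
  pos    = splitCol w₁ P₁.pos    (shifted P₂.pos)
  neg    = splitCol w₁ P₁.neg    (shifted P₂.neg)
  swap   = splitCol w₁ P₁.swap   (shifted P₂.swap)
  posCol = splitVal w₁ P₁.posCol (shifted P₂.posCol)
  negCol = splitVal w₁ P₁.negCol (shifted P₂.negCol)

  colour : ℕ → Bool
  colour = splitVal w₁ P₁.colour P₂.colour

  private
    lowerBounds : ∀ {x} → 1 ≤ x × x ≤ w₂ → 1 ≤ w₁ + x × w₁ + x ≤ w₁ + w₂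
    lowerBounds (1≤x , x≤w₂) = ℕP.≤-trans 1≤x (ℕP.m≤n+m _ w₁) , ℕP.+-monoʳ-≤ w₁ x≤w₂

    upperBounds : ∀ {x} → 1 ≤ x × x ≤ w₁ → 1 ≤ x × x ≤ w₁ + w₂
    upperBounds (1≤x , x≤w₁) = 1≤x , ℕP.≤-trans x≤w₁ w₁≤

    column-ok : ∀ {j} → j < w₁ + w₂ →
      (1 ≤ pos j × pos j ≤ w₁ + w₂) × (1 ≤ neg j × neg j ≤ w₁ + w₂) × colour (pos j) ≢ colour (neg j)
    column-ok {j} j< with rowView w₁ j
    ... | upper j<w₁ with P₁.column-ok j<w₁
    ...   | pos∈ , neg∈ , colour≢ rewrite splitCol-< w₁ P₁.pos (shifted P₂.pos) j<w₁ | splitCol-< w₁ P₁.neg (shifted P₂.neg) j<w₁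
                                        | splitVal-≤ w₁ P₁.colour P₂.colour (proj₂ pos∈) | splitVal-≤ w₁ P₁.colour P₂.colour (proj₂ neg∈)
          = upperBounds pos∈ , upperBounds neg∈ , colour≢
    column-ok {j} j< | lower o with P₂.column-ok (ℕP.+-cancelˡ-< w₁ o w₂ j<)
    ...   | pos∈ , neg∈ , colour≢ rewrite splitCol-+ w₁ P₁.pos (shifted P₂.pos) o | splitCol-+ w₁ P₁.neg (shifted P₂.neg) o
                                        | splitVal-+ w₁ P₁.colour P₂.colour (proj₁ pos∈) | splitVal-+ w₁ P₁.colour P₂.colour (proj₁ neg∈)
          = lowerBounds pos∈ , lowerBounds neg∈ , colour≢

    splitInverse : (f₁ fCol₁ f₂ fCol₂ : ℕ → ℕ) →
      (∀ {v} → 1 ≤ v → v ≤ w₁ → fCol₁ v < w₁ × f₁ (fCol₁ v) ≡ v) →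
      (∀ {v} → 1 ≤ v → v ≤ w₂ → fCol₂ v < w₂ × f₂ (fCol₂ v) ≡ v) →
      ∀ {v} → 1 ≤ v → v ≤ w₁ + w₂ →
      splitVal w₁ fCol₁ (shifted fCol₂) v < w₁ + w₂ × splitCol w₁ f₁ (shifted f₂) (splitVal w₁ fCol₁ (shifted fCol₂) v) ≡ v
    splitInverse f₁ fCol₁ f₂ fCol₂ ok₁ ok₂ {v} 1≤v v≤ with valView w₁ v
    ... | low v≤w₁ with ok₁ 1≤v v≤w₁
    ...   | c< , f₁c≡v rewrite splitVal-≤ w₁ fCol₁ (shifted fCol₂) v≤w₁ | splitCol-< w₁ f₁ (shifted f₂) c<
          = ℕP.<-≤-trans c< w₁≤ , f₁c≡v
    splitInverse f₁ fCol₁ f₂ fCol₂ ok₁ ok₂ {.(w₁ + x)} _ v≤ | high x 1≤x with ok₂ 1≤x (ℕP.+-cancelˡ-≤ w₁ x w₂ v≤)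
    ...   | c< , f₂c≡x rewrite splitVal-+ w₁ fCol₁ (shifted fCol₂) 1≤x | splitCol-+ w₁ f₁ (shifted f₂) (fCol₂ x)
          = ℕP.+-monoʳ-< w₁ c< , cong (λ z → w₁ + z) f₂c≡x

    rem2-w₁+ : ∀ x → rem2 (w₁ + x) ≡ rem2 x
    rem2-w₁+ x rewrite P₁.width≡ = rem2-+ h₁ x

    swap-ok : ∀ {j} → j < w₁ + w₂ → swap j < w₁ + w₂ × swap (swap j) ≡ j
    swap-ok {j} j< with rowView w₁ j
    ... | upper j<w₁ with P₁.swap-ok j<w₁
    ...   | s< , ss≡j rewrite splitCol-< w₁ P₁.swap (shifted P₂.swap) j<w₁ | splitCol-< w₁ P₁.swap (shifted P₂.swap) s<
          = ℕP.<-≤-trans s< w₁≤ , ss≡j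
    swap-ok {j} j< | lower o with P₂.swap-ok (ℕP.+-cancelˡ-< w₁ o w₂ j<)
    ...   | s< , ss≡o rewrite splitCol-+ w₁ P₁.swap (shifted P₂.swap) o | splitCol-+ w₁ P₁.swap (shifted P₂.swap) (P₂.swap o)
          = ℕP.+-monoʳ-< w₁ s< , cong (λ z → w₁ + z) ss≡o

    ρ ρ₁ ρ₂ : ℕ → ℤ
    ρ  = StandardRow.at (h₁ + h₂)
    ρ₁ = StandardRow.at h₁
    ρ₂ = StandardRow.at h₂

    ρ-upper : ∀ {j} → j < w₁ → ρ j ≡ ρ₁ j +ℤ signedBy (rem2 j) (+ h₂)
    ρ-upper j<w₁ = standardRow-+ˡ h₁ h₂ (subst (_ <_) P₁.width≡ j<w₁)

    ρ-lower : ∀ o → ρ (w₁ + o) ≡ ρ₂ o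
    ρ-lower o rewrite P₁.width≡ = standardRow-+ʳ h₁ h₂ o

    +[a+x]-+[a+y] : ∀ a x y → + (a + x) -ℤ + (a + y) ≡ + x -ℤ + y
    +[a+x]-+[a+y] a x y = trans (cong₂ _-ℤ_ (ℤP.pos-+ a x) (ℤP.pos-+ a y)) (cancel (+ a) (+ x) (+ y))
      where cancel : ∀ (A X Y : ℤ) → (A +ℤ X) -ℤ (A +ℤ Y) ≡ X -ℤ Y
            cancel = solve-∀

    balance : ∀ {j} → j < w₁ + w₂ → ρ (swap j) +ℤ (+ pos j -ℤ + neg j) ≡ ρ j
    balance {j} j< with rowView w₁ j
    ... | upper j<w₁
      rewrite splitCol-< w₁ P₁.swap (shifted P₂.swap) j<w₁ | splitCol-< w₁ P₁.pos (shifted P₂.pos) j<w₁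
            | splitCol-< w₁ P₁.neg (shifted P₂.neg) j<w₁ = begin
        ρ (P₁.swap j) +ℤ d                                        ≡⟨ cong (_+ℤ d) (ρ-upper (proj₁ (P₁.swap-ok j<w₁))) ⟩
        (ρ₁ (P₁.swap j) +ℤ signedBy (rem2 (P₁.swap j)) (+ h₂)) +ℤ d ≡⟨ cong (λ s → (ρ₁ (P₁.swap j) +ℤ signedBy s (+ h₂)) +ℤ d) (parity₁ j<w₁) ⟩
        (ρ₁ (P₁.swap j) +ℤ c) +ℤ d                                ≡⟨ rearrange (ρ₁ (P₁.swap j)) c d ⟩
        (ρ₁ (P₁.swap j) +ℤ d) +ℤ c                                ≡⟨ cong (_+ℤ c) (P₁.balance j<w₁) ⟩
        ρ₁ j +ℤ c                                                 ≡⟨ sym (ρ-upper j<w₁) ⟩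
        ρ j ∎
      where
      open ≡-Reasoning
      d = + P₁.pos j -ℤ + P₁.neg j
      c = signedBy (rem2 j) (+ h₂)
      rearrange : ∀ (a c d : ℤ) → (a +ℤ c) +ℤ d ≡ (a +ℤ d) +ℤ c
      rearrange = solve-∀
    ... | lower o
      rewrite splitCol-+ w₁ P₁.swap (shifted P₂.swap) o | splitCol-+ w₁ P₁.pos (shifted P₂.pos) o
            | splitCol-+ w₁ P₁.neg (shifted P₂.neg) o = begin
        ρ (w₁ + P₂.swap o) +ℤ (+ (w₁ + P₂.pos o) -ℤ + (w₁ + P₂.neg o))
          ≡⟨ cong₂ _+ℤ_ (ρ-lower (P₂.swap o)) (+[a+x]-+[a+y] w₁ (P₂.pos o) (P₂.neg o)) ⟩
        ρ₂ (P₂.swap o) +ℤ (+ P₂.pos o -ℤ + P₂.neg o) ≡⟨ P₂.balance (ℕP.+-cancelˡ-< w₁ o w₂ j<) ⟩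
        ρ₂ o                                         ≡⟨ sym (ρ-lower o) ⟩
        ρ (w₁ + o) ∎
      where open ≡-Reasoning

  concat : Pattern (w₁ + w₂) (h₁ + h₂)
  concat = record
    { width≡ = trans (cong₂ _+_ P₁.width≡ P₂.width≡) (+-interchange h₁ h₁ h₂ h₂)
    ; spec = record
      { pos = pos ; neg = neg ; posCol = posCol ; negCol = negCol ; colour = colour
      ; column-ok = column-ok
      ; posCol-ok = splitInverse P₁.pos P₁.posCol P₂.pos P₂.posCol P₁.posCol-ok P₂.posCol-ok
      ; negCol-ok = splitInverse P₁.neg P₁.negCol P₂.neg P₂.negCol P₁.negCol-ok P₂.negCol-ok }
    ; swap = swap ; swap-ok = swap-ok ; balance = balance }
    where +-interchange : ∀ a b c d → (a + b) + (c + d) ≡ (a + c) + (b + d)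
          +-interchange = ℕ-solve

  concat-keepsParity : SwapKeepsParity p₂ → SwapKeepsParity concat
  concat-keepsParity parity₂ {j} j< with rowView w₁ j
  ... | upper j<w₁ rewrite splitCol-< w₁ P₁.swap (shifted P₂.swap) j<w₁ = parity₁ j<w₁
  ... | lower o rewrite splitCol-+ w₁ P₁.swap (shifted P₂.swap) o =
    trans (rem2-w₁+ (P₂.swap o)) (trans (parity₂ (ℕP.+-cancelˡ-< w₁ o w₂ j<)) (sym (rem2-w₁+ o)))

module FromTables (w h : ℕ) (pos neg posCol negCol swap : ℕ → ℕ) (colour : ℕ → Bool) where
  ColumnOk : ℕ → Set
  ColumnOk j = (1 ≤ pos j × pos j ≤ w) × (1 ≤ neg j × neg j ≤ w) × colour (pos j) ≢ colour (neg j)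

  columnOk? : ∀ j → Dec (ColumnOk j)
  columnOk? j = ((1 ≤? pos j) ×-dec (pos j ≤? w)) ×-dec ((1 ≤? neg j) ×-dec (neg j ≤? w))
                ×-dec ¬? (colour (pos j) Bool.≟ colour (neg j))

  InverseAt : (ℕ → ℕ) → (ℕ → ℕ) → ℕ → Set
  InverseAt f fCol x = fCol (suc x) < w × f (fCol (suc x)) ≡ suc x

  inverseAt? : ∀ f fCol x → Dec (InverseAt f fCol x)
  inverseAt? f fCol x = (fCol (suc x) <? w) ×-dec (f (fCol (suc x)) ℕ.≟ suc x)

  SwapOk : ℕ → Set
  SwapOk j = swap j < w × swap (swap j) ≡ j

  swapOk? : ∀ j → Dec (SwapOk j)
  swapOk? j = (swap j <? w) ×-dec (swap (swap j) ℕ.≟ j)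

  Balanced : ℕ → Set
  Balanced j = StandardRow.at h (swap j) +ℤ (+ pos j -ℤ + neg j) ≡ StandardRow.at h j

  balanced? : ∀ j → Dec (Balanced j)
  balanced? j = StandardRow.at h (swap j) +ℤ (+ pos j -ℤ + neg j) ℤ.≟ StandardRow.at h j

  private
    shiftUp : ∀ f fCol → (∀ {x} → x < w → InverseAt f fCol x) → ∀ {v} → 1 ≤ v → v ≤ w → fCol v < w × f (fCol v) ≡ v
    shiftUp f fCol inv {suc x} _ x<w = inv x<w

  tablePattern : w ≡ h + h →
    True (ℕP.allUpTo? columnOk? w) → True (ℕP.allUpTo? (inverseAt? pos posCol) w) →
    True (ℕP.allUpTo? (inverseAt? neg negCol) w) → True (ℕP.allUpTo? swapOk? w) →
    True (ℕP.allUpTo? balanced? w) → Pattern w h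
  tablePattern w≡ cols poss negs swaps bals = record
    { width≡ = w≡
    ; spec = record
      { pos = pos ; neg = neg ; posCol = posCol ; negCol = negCol ; colour = colour
      ; column-ok = toWitness cols
      ; posCol-ok = shiftUp pos posCol (toWitness poss)
      ; negCol-ok = shiftUp neg negCol (toWitness negs) }
    ; swap = swap
    ; swap-ok = toWitness swaps
    ; balance = toWitness bals }

emptyPattern : Pattern 0 0
emptyPattern = FromTables.tablePattern 0 0 id id id id id (λ _ → true) refl _ _ _ _ _

module FourColumns where
  pos neg posCol negCol swap : ℕ → ℕ
  pos 0 = 2
  pos 1 = 1
  pos 2 = 3
  pos _ = 4
  neg 0 = 1
  neg 1 = 2
  neg 2 = 4
  neg _ = 3
  posCol 1 = 1
  posCol 2 = 0
  posCol 3 = 2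
  posCol _ = 3
  negCol 1 = 0
  negCol 2 = 1
  negCol 3 = 3
  negCol _ = 2
  swap 0 = 2
  swap 1 = 3
  swap 2 = 0
  swap _ = 1

  even : ℕ → Bool
  even zero          = true
  even (suc zero)    = false
  even (suc (suc n)) = even n

  pattern₄ : Pattern 4 2
  pattern₄ = FromTables.tablePattern 4 2 pos neg posCol negCol swap even refl _ _ _ _ _

  pattern₄-keepsParity : SwapKeepsParity pattern₄
  pattern₄-keepsParity = toWitness {a? = ℕP.allUpTo? (λ j → rem2 (swap j) ℕ.≟ rem2 j) 4} _

-- For odd half-widths. Its swap exchanges the columns of +1 and -1, so it can only close a concatenation.
module SixColumns where
  pos neg posCol negCol swap : ℕ → ℕ
  pos 0 = 2
  pos 1 = 1
  pos 2 = 3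
  pos 3 = 6
  pos 4 = 5
  pos _ = 4
  neg 0 = 1
  neg 1 = 2
  neg 2 = 4
  neg 3 = 5
  neg 4 = 3
  neg _ = 6
  posCol 1 = 1
  posCol 2 = 0
  posCol 3 = 2
  posCol 4 = 5
  posCol 5 = 4
  posCol _ = 3
  negCol 1 = 0
  negCol 2 = 1
  negCol 3 = 4
  negCol 4 = 2
  negCol 5 = 3
  negCol _ = 5
  swap 0 = 2
  swap 1 = 3
  swap 2 = 0
  swap 3 = 1
  swap 4 = 5
  swap _ = 4

  colour : ℕ → Bool
  colour 2 = true
  colour 4 = true
  colour 5 = true
  colour _ = false

  pattern₆ : Pattern 6 3
  pattern₆ = FromTables.tablePattern 6 3 pos neg posCol negCol swap colour refl _ _ _ _ _

repeatedPattern : ∀ k → Σ (Pattern (k * 4) (k * 2)) SwapKeepsParity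
repeatedPattern zero    = emptyPattern , λ ()
repeatedPattern (suc k) = Concat.concat pattern₄ pattern₄-keepsParity p , Concat.concat-keepsParity pattern₄ pattern₄-keepsParity p parity
  where open FourColumns using (pattern₄; pattern₄-keepsParity)
        p : Pattern (k * 4) (k * 2)
        p = proj₁ (repeatedPattern k)
        parity : SwapKeepsParity p
        parity = proj₂ (repeatedPattern k)

halves : ∀ h → ∃ λ e → h ≡ e * 2 + 0 ⊎ h ≡ e * 2 + 1
halves = elim2 (λ e → e , inj₁ refl) (λ e → e , inj₂ refl)

reshape : ∀ {w h h'} → h ≡ h' → Pattern w h → Pattern (h' + h') h'
reshape refl p = subst (λ w → Pattern w _) (Pattern.width≡ p) p

patternOfHalfWidth : ∀ h → 2 ≤ h → Pattern (h + h) h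
patternOfHalfWidth h 2≤h with halves h
... | e , inj₁ h≡ = reshape (trans (sym (ℕP.+-identityʳ (e * 2))) (sym h≡)) (proj₁ (repeatedPattern e))
... | zero  , inj₂ refl = ⊥-elim (ℕP.<-irrefl refl (ℕP.≤-pred 2≤h))
... | suc d , inj₂ refl = reshape (eq d) (Concat.concat (proj₁ (repeatedPattern d)) (proj₂ (repeatedPattern d)) SixColumns.pattern₆)
  where eq : ∀ d → d * 2 + 3 ≡ suc d * 2 + 1
        eq = ℕ-solve

-- Blocks with vanishing column sums

record MagicBlock (m t : ℕ) : Set where
  field
    block    : Block m (t + t)
    bound≡   : Block.bound block ≡ m * t
    colSum≡0 : ∀ j → j < t + t → colSum block j ≡ 0ℤ

magicBlock⇒SMA : ∀ {m t} → MagicBlock m t → ∃[ A ] (IsSMA m (t + t) A × PairsInSameRow m (t + t) A)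
magicBlock⇒SMA {m} {t} M = block⇒SMA block (trans bound≡ (sym half≡)) colSum≡0
  where
  open MagicBlock M
  half≡ : half m (t + t) ≡ m * t
  half≡ = trans (cong (_/ 2) (eq m t)) (m*n/n≡m (m * t) 2)
    where eq : ∀ m t → m * (t + t) ≡ m * t * 2
          eq = ℕ-solve

colSum-stack-twoRow : ∀ {r n} (B : Block r n) (S : TwoRowSpec n) {j} → j < n →
  colSum (stack B (TwoRow.block S)) j ≡ colSum B j +ℤ (+ TwoRowSpec.pos S j -ℤ + TwoRowSpec.neg S j)
colSum-stack-twoRow B S {j} j< = begin
  colSum (stack B (TwoRow.block S)) j
    ≡⟨ colSum-stack B (TwoRow.block S) j ⟩
  colSum B j +ℤ (colSum (TwoRow.block S) j +ℤ K *ℤ colSgnSum (TwoRow.block S) j)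
    ≡⟨ cong₂ (λ x y → colSum B j +ℤ (x +ℤ K *ℤ y)) (TwoRow.colSum-block S j) (TwoRow.colSgnSum-block S j<) ⟩
  colSum B j +ℤ (d +ℤ K *ℤ 0ℤ)
    ≡⟨ cong (λ x → colSum B j +ℤ (d +ℤ x)) (ℤP.*-zeroʳ K) ⟩
  colSum B j +ℤ (d +ℤ 0ℤ)
    ≡⟨ cong (colSum B j +ℤ_) (ℤP.+-identityʳ d) ⟩
  colSum B j +ℤ d ∎
  where open ≡-Reasoning
        K = + Block.bound B
        d = + TwoRowSpec.pos S j -ℤ + TwoRowSpec.neg S j

magic3 : ∀ h u → u ≤ h → h ≤ suc u → 1 ≤ h → MagicBlock 3 (h + u)
magic3 h u u≤h h≤1+u 1≤h = record
  { block = stack ρ (TwoRow.block spec) ; bound≡ = eq t ; colSum≡0 = colSum≡0 }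
  where
  open ThreeRow h u u≤h h≤1+u 1≤h using (t; spec; pos; neg; zeroColumn)
  ρ : Block 1 (t + t)
  ρ = rowBlock (StandardRow.row t)
  eq : ∀ t → t + (t + t) ≡ 3 * t
  eq = ℕ-solve
  colSum≡0 : ∀ j → j < t + t → colSum (stack ρ (TwoRow.block spec)) j ≡ 0ℤ
  colSum≡0 j j< = trans (colSum-stack-twoRow ρ spec j<)
    (trans (cong (_+ℤ (+ pos j -ℤ + neg j)) (colSum-rowBlock (StandardRow.row t) j)) (zeroColumn j<))

-- The standard row read through swap, above the two-row block of the three-row base and a pattern:
-- the pattern turns the first row back into the standard row, which the two-row block then cancels.
magic5 : ∀ h u → u ≤ h → h ≤ suc u → 1 ≤ h → Pattern ((h + u) + (h + u)) (h + u) → MagicBlock 5 (h + u)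
magic5 h u u≤h h≤1+u 1≤h p = record
  { block = stack (stack ρ′ (TwoRow.block spec)) (TwoRow.block P.spec) ; bound≡ = eq t ; colSum≡0 = colSum≡0 }
  where
  open ThreeRow h u u≤h h≤1+u 1≤h using (t; spec; pos; neg; zeroColumn)
  module P = Pattern p
  swappedRow : Row (t + t) t
  swappedRow = permuteRow (StandardRow.row t) P.swap (λ j< → proj₁ (P.swap-ok j<)) (λ j< → proj₂ (P.swap-ok j<))
  ρ′ : Block 1 (t + t)
  ρ′ = rowBlock swappedRow
  eq : ∀ t → (t + (t + t)) + (t + t) ≡ 5 * t
  eq = ℕ-solve
  rearrange : ∀ (a b c : ℤ) → (a +ℤ b) +ℤ c ≡ (a +ℤ c) +ℤ b
  rearrange = solve-∀
  colSum≡0 : ∀ j → j < t + t → colSum (stack (stack ρ′ (TwoRow.block spec)) (TwoRow.block P.spec)) j ≡ 0ℤ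
  colSum≡0 j j< = begin
    colSum (stack (stack ρ′ (TwoRow.block spec)) (TwoRow.block P.spec)) j ≡⟨ colSum-stack-twoRow (stack ρ′ (TwoRow.block spec)) P.spec j< ⟩
    colSum (stack ρ′ (TwoRow.block spec)) j +ℤ d₂                         ≡⟨ cong (_+ℤ d₂) (colSum-stack-twoRow ρ′ spec j<) ⟩
    (colSum ρ′ j +ℤ d₁) +ℤ d₂                                            ≡⟨ cong (λ x → (x +ℤ d₁) +ℤ d₂) (colSum-rowBlock swappedRow j) ⟩
    (StandardRow.at t (P.swap j) +ℤ d₁) +ℤ d₂                             ≡⟨ rearrange (StandardRow.at t (P.swap j)) d₁ d₂ ⟩
    (StandardRow.at t (P.swap j) +ℤ d₂) +ℤ d₁                             ≡⟨ cong (_+ℤ d₁) (P.balance j<) ⟩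
    StandardRow.at t j +ℤ d₁                                             ≡⟨ zeroColumn j< ⟩
    0ℤ ∎
    where open ≡-Reasoning
          d₁ = + pos j -ℤ + neg j
          d₂ = + P.pos j -ℤ + P.neg j

-- Rows ρ, -ρ, -ρ, ρ with magnitudes shifted by 0, K, 2K, 3K: both the entries and the shifts cancel.
module FourRow {n K} (ρ : Row n K) where
  private
    R R⁻ : Block 1 n
    R  = rowBlock ρ
    R⁻ = rowBlock (negateRow ρ)
    lower₂ : Block 2 n
    lower₂ = stack R⁻ R
    lower₃ : Block 3 n
    lower₃ = stack R⁻ lower₂

  block : Block 4 n
  block = stack R lower₃

  private
    colSum-R⁻ : ∀ j → colSum R⁻ j ≡ - colSum R j
    colSum-R⁻ j = trans (colSum-rowBlock (negateRow ρ) j) (cong -_ (sym (colSum-rowBlock ρ j)))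

    colSgnSum-R⁻ : ∀ j → colSgnSum R⁻ j ≡ - colSgnSum R j
    colSgnSum-R⁻ j = trans (colSgnSum-rowBlock (negateRow ρ) j)
      (trans (sgn-neg (Row.at ρ j)) (cong -_ (sym (colSgnSum-rowBlock ρ j))))

    colSum-identity : ∀ a s k → a +ℤ ((- a +ℤ ((- a +ℤ (a +ℤ k *ℤ s)) +ℤ k *ℤ (- s +ℤ s))) +ℤ k *ℤ (- s +ℤ (- s +ℤ s))) ≡ 0ℤ
    colSum-identity = solve-∀

    colSgnSum-identity : ∀ s → s +ℤ (- s +ℤ (- s +ℤ s)) ≡ 0ℤ
    colSgnSum-identity = solve-∀

  colSgnSum-block : ∀ j → colSgnSum block j ≡ 0ℤ
  colSgnSum-block j = begin
    colSgnSum block j                                          ≡⟨ colSgnSum-stack R lower₃ j ⟩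
    s +ℤ colSgnSum lower₃ j                                    ≡⟨ cong (s +ℤ_) (colSgnSum-stack R⁻ lower₂ j) ⟩
    s +ℤ (colSgnSum R⁻ j +ℤ colSgnSum lower₂ j)                ≡⟨ cong (λ x → s +ℤ (colSgnSum R⁻ j +ℤ x)) (colSgnSum-stack R⁻ R j) ⟩
    s +ℤ (colSgnSum R⁻ j +ℤ (colSgnSum R⁻ j +ℤ s))             ≡⟨ cong (λ x → s +ℤ (x +ℤ (x +ℤ s))) (colSgnSum-R⁻ j) ⟩
    s +ℤ (- s +ℤ (- s +ℤ s))                                   ≡⟨ colSgnSum-identity s ⟩
    0ℤ ∎
    where open ≡-Reasoning
          s = colSgnSum R j

  colSum-block : ∀ j → colSum block j ≡ 0ℤ
  colSum-block j = begin
    colSum block j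
      ≡⟨ colSum-stack R lower₃ j ⟩
    a +ℤ (colSum lower₃ j +ℤ k *ℤ colSgnSum lower₃ j)
      ≡⟨ cong₂ (λ x y → a +ℤ (x +ℤ k *ℤ y)) (colSum-stack R⁻ lower₂ j) (colSgnSum-stack R⁻ lower₂ j) ⟩
    a +ℤ ((b +ℤ (colSum lower₂ j +ℤ k *ℤ colSgnSum lower₂ j)) +ℤ k *ℤ (s′ +ℤ colSgnSum lower₂ j))
      ≡⟨ cong₂ (λ x y → a +ℤ ((b +ℤ (x +ℤ k *ℤ y)) +ℤ k *ℤ (s′ +ℤ y))) (colSum-stack R⁻ R j) (colSgnSum-stack R⁻ R j) ⟩
    a +ℤ ((b +ℤ ((b +ℤ (a +ℤ k *ℤ s)) +ℤ k *ℤ (s′ +ℤ s))) +ℤ k *ℤ (s′ +ℤ (s′ +ℤ s)))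
      ≡⟨ cong₂ (λ b s′ → a +ℤ ((b +ℤ ((b +ℤ (a +ℤ k *ℤ s)) +ℤ k *ℤ (s′ +ℤ s))) +ℤ k *ℤ (s′ +ℤ (s′ +ℤ s)))) (colSum-R⁻ j) (colSgnSum-R⁻ j) ⟩
    a +ℤ ((- a +ℤ ((- a +ℤ (a +ℤ k *ℤ s)) +ℤ k *ℤ (- s +ℤ s))) +ℤ k *ℤ (- s +ℤ (- s +ℤ s)))
      ≡⟨ colSum-identity a s k ⟩
    0ℤ ∎
    where open ≡-Reasoning
          k = + K
          a = colSum R j
          b = colSum R⁻ j
          s = colSgnSum R j
          s′ = colSgnSum R⁻ j

magic+4 : ∀ {m t} → MagicBlock m t → MagicBlock (m + 4) t
magic+4 {m} {t} M = record
  { block = stack block G ; bound≡ = trans (cong (_+ 4t) bound≡) (eq m t) ; colSum≡0 = colSum≡0′ }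
  where
  open MagicBlock M
  open FourRow (StandardRow.row t) using () renaming (block to G; colSum-block to colSum-G; colSgnSum-block to colSgnSum-G)
  4t : ℕ
  4t = t + (t + (t + t))
  eq : ∀ m t → m * t + (t + (t + (t + t))) ≡ (m + 4) * t
  eq = ℕ-solve
  colSum≡0′ : ∀ j → j < t + t → colSum (stack block G) j ≡ 0ℤ
  colSum≡0′ j j< = begin
    colSum (stack block G) j                                                   ≡⟨ colSum-stack block G j ⟩
    colSum block j +ℤ (colSum G j +ℤ (+ Block.bound block) *ℤ colSgnSum G j) ≡⟨ cong₂ (λ x y → x +ℤ (y +ℤ (+ Block.bound block) *ℤ colSgnSum G j)) (colSum≡0 j j<) (colSum-G j) ⟩
    0ℤ +ℤ (0ℤ +ℤ (+ Block.bound block) *ℤ colSgnSum G j)                     ≡⟨ cong (λ y → 0ℤ +ℤ (0ℤ +ℤ (+ Block.bound block) *ℤ y)) (colSgnSum-G j) ⟩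
    0ℤ +ℤ (0ℤ +ℤ (+ Block.bound block) *ℤ 0ℤ)                                ≡⟨ cong (λ y → 0ℤ +ℤ (0ℤ +ℤ y)) (ℤP.*-zeroʳ (+ Block.bound block)) ⟩
    0ℤ ∎
    where open ≡-Reasoning

magic+4* : ∀ {m t} → MagicBlock m t → ∀ q → MagicBlock (m + q * 4) t
magic+4* {m} {t} M zero    = subst (λ m → MagicBlock m t) (sym (ℕP.+-identityʳ m)) M
magic+4* {m} {t} M (suc q) = subst (λ m → MagicBlock m t) (eq m q) (magic+4 (magic+4* M q))
  where eq : ∀ m q → m + q * 4 + 4 ≡ m + suc q * 4
        eq = ℕ-solve

-- No SMA(m, 2) when 1 + ⋯ + m is odd

sumℕ : ℕ → (ℕ → ℕ) → ℕ
sumℕ zero    f = 0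
sumℕ (suc n) f = f 0 + sumℕ n (λ k → f (suc k))

∑<-+ : ∀ n (f : ℕ → ℕ) → ∑< n (λ k → + f k) ≡ + sumℕ n f
∑<-+ zero    f = refl
∑<-+ (suc n) f = trans (cong (+ f 0 +ℤ_) (∑<-+ n (λ k → f (suc k)))) (sym (ℤP.pos-+ (f 0) _))

sumℕ-snoc : ∀ n (f : ℕ → ℕ) → sumℕ (suc n) f ≡ sumℕ n f + f n
sumℕ-snoc zero    f = ℕP.+-comm (f 0) 0
sumℕ-snoc (suc n) f = trans (cong (λ z → f 0 + z) (sumℕ-snoc n (λ k → f (suc k)))) (sym (ℕP.+-assoc (f 0) _ _))

gauss : ∀ n → sumℕ n suc + sumℕ n suc ≡ n * suc n
gauss zero    = refl
gauss (suc n) = begin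
    sumℕ (suc n) suc + sumℕ (suc n) suc     ≡⟨ cong₂ _+_ (sumℕ-snoc n suc) (sumℕ-snoc n suc) ⟩
    (S + suc n) + (S + suc n)               ≡⟨ interchange S (suc n) ⟩
    (S + S) + (suc n + suc n)               ≡⟨ cong (_+ (suc n + suc n)) (gauss n) ⟩
    n * suc n + (suc n + suc n)             ≡⟨ eq n ⟩
    suc n * suc (suc n) ∎
  where open ≡-Reasoning
        S = sumℕ n suc
        interchange : ∀ a b → (a + b) + (a + b) ≡ (a + a) + (b + b)
        interchange = ℕ-solve
        eq : ∀ n → n * suc n + (suc n + suc n) ≡ suc n * suc (suc n)
        eq = ℕ-solve

negPart : ℤ → ℤ
negPart (+ n)     = 0ℤ
negPart -[1+ n ] = + suc n

∣x∣≡x+2negPart : ∀ x → + ∣ x ∣ ≡ x +ℤ (negPart x +ℤ negPart x)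
∣x∣≡x+2negPart (+ n)     = sym (ℤP.+-identityʳ (+ n))
∣x∣≡x+2negPart -[1+ n ] = eq (+ suc n)
  where eq : ∀ X → X ≡ - X +ℤ (X +ℤ X)
        eq = solve-∀

suc-pred∣x∣ : ∀ {x} → x ≢ 0ℤ → suc (ℕ.pred ∣ x ∣) ≡ ∣ x ∣
suc-pred∣x∣ {+ zero}    x≢0 = ⊥-elim (x≢0 refl)
suc-pred∣x∣ {+[1+ n ]} _   = refl
suc-pred∣x∣ { -[1+ n ]} _  = refl

-- In an SMA(m, 2) the first column holds one of ±k for each k ≤ m, and sums to 0;
-- so 1 + ⋯ + m = ∑ ∣aᵢ∣ = ∑ aᵢ + 2 ∑ negPart aᵢ is even.
module SMA-2Columns {m} {A : Array m 2} (isSMA : IsSMA m 2 A) where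
  open IsSMA isSMA

  private
    a : Fin m → ℤ
    a i = A i Fin.zero

    half≡m : half m 2 ≡ m
    half≡m = m*n/n≡m m 2

    second≡-first : ∀ i → A i (Fin.suc Fin.zero) ≡ - a i
    second≡-first i = trans (eq (a i) (A i (Fin.suc Fin.zero))) (trans (cong (- a i +ℤ_) (rowSums i)) (ℤP.+-identityʳ (- a i)))
      where eq : ∀ x y → y ≡ - x +ℤ (x +ℤ (y +ℤ 0ℤ))
            eq = solve-∀

    a-InX : ∀ i → InX m 2 (a i)
    a-InX i = entriesInX i Fin.zero

    ∣a∣-1< : ∀ i → ℕ.pred ∣ a i ∣ < m
    ∣a∣-1< i = subst (_≤ m) (sym (suc-pred∣x∣ (proj₁ (a-InX i)))) (subst (∣ a i ∣ ≤_) half≡m (proj₂ (a-InX i)))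

    magnitude : Fin m → Fin m
    magnitude i = fromℕ< (∣a∣-1< i)

    toℕ-magnitude : ∀ i → toℕ (magnitude i) ≡ ℕ.pred ∣ a i ∣
    toℕ-magnitude i = FinP.toℕ-fromℕ< (∣a∣-1< i)

    1+k∈X : ∀ (k : Fin m) → InX m 2 (+ suc (toℕ k))
    1+k∈X k = (λ ()) , subst (suc (toℕ k) ≤_) (sym half≡m) (FinP.toℕ<n k)

    rowOf : Fin m → Fin m
    rowOf k = proj₁ (appearsOnce _ (1+k∈X k))

    ∣a∣-in-row : ∀ i → Σ (Fin 2) λ j → A i j ≡ + ∣ a i ∣
    ∣a∣-in-row i with A i Fin.zero in eq
    ... | + n     = Fin.zero , eq
    ... | -[1+ n ] = Fin.suc Fin.zero , trans (second≡-first i) (cong -_ eq)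

    ∣a∣≡ : ∀ i (j : Fin 2) v → A i j ≡ + v → ∣ a i ∣ ≡ v
    ∣a∣≡ i Fin.zero           v eq = cong ∣_∣ eq
    ∣a∣≡ i (Fin.suc Fin.zero) v eq = trans (sym (ℤP.∣-i∣≡∣i∣ (a i))) (cong ∣_∣ (trans (sym (second≡-first i)) eq))

    magnitude-rowOf : ∀ k → magnitude (rowOf k) ≡ k
    magnitude-rowOf k = FinP.toℕ-injective (trans (toℕ-magnitude (rowOf k)) (cong ℕ.pred (∣a∣≡ (rowOf k) j _ A≡)))
      where j   = proj₁ (proj₂ (appearsOnce _ (1+k∈X k)))
            A≡ = proj₁ (proj₂ (proj₂ (appearsOnce _ (1+k∈X k))))

    rowOf-magnitude : ∀ i → rowOf (magnitude i) ≡ i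
    rowOf-magnitude i = sym (proj₁ (unique i (proj₁ (∣a∣-in-row i)) (trans (proj₂ (∣a∣-in-row i)) ∣a∣≡1+k)))
      where unique = proj₂ (proj₂ (proj₂ (appearsOnce _ (1+k∈X (magnitude i)))))
            ∣a∣≡1+k : + ∣ a i ∣ ≡ + suc (toℕ (magnitude i))
            ∣a∣≡1+k = cong +_ (trans (sym (suc-pred∣x∣ (proj₁ (a-InX i)))) (cong suc (sym (toℕ-magnitude i))))

  triangle-even : ∃ λ c → c + c ≡ sumℕ m suc
  triangle-even = nonNegative C (sym (begin
      + sumℕ m suc                                          ≡⟨ sym (∑<-+ m suc) ⟩
      ∑< m (λ k → + suc k)                                  ≡⟨ sym (ΣFin≡∑< m (λ k → + suc k)) ⟩
      ΣFin m (λ k → + suc (toℕ k))                          ≡⟨ ΣFin≡sum m (λ k → + suc (toℕ k)) ⟩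
      sum {m} (λ k → + suc (toℕ k))                         ≡⟨ sum-permute (λ k → + suc (toℕ k)) magnitudes ⟩
      sum {m} (λ i → + suc (toℕ (magnitude i)))             ≡⟨ sum-cong-≗ 1+magnitude≡ ⟩
      sum {m} (λ i → a i +ℤ (negParts i +ℤ negParts i))     ≡⟨ ∑-distrib-+ a (λ i → negParts i +ℤ negParts i) ⟩
      sum {m} a +ℤ sum {m} (λ i → negParts i +ℤ negParts i) ≡⟨ cong₂ _+ℤ_ (trans (sym (ΣFin≡sum m a)) (colSums Fin.zero)) (∑-distrib-+ negParts negParts) ⟩
      0ℤ +ℤ (C +ℤ C)                                        ≡⟨ ℤP.+-identityˡ (C +ℤ C) ⟩
      C +ℤ C ∎))
    where
    open ≡-Reasoning
    magnitudes : Permutation m m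
    magnitudes = permutation magnitude rowOf magnitude-rowOf rowOf-magnitude
    negParts : Fin m → ℤ
    negParts i = negPart (a i)
    C : ℤ
    C = sum {m} negParts
    1+magnitude≡ : ∀ i → + suc (toℕ (magnitude i)) ≡ a i +ℤ (negParts i +ℤ negParts i)
    1+magnitude≡ i = trans (cong (λ z → + suc z) (toℕ-magnitude i)) (trans (cong +_ (suc-pred∣x∣ (proj₁ (a-InX i)))) (∣x∣≡x+2negPart (a i)))
    nonNegative : ∀ C {N} → C +ℤ C ≡ + N → ∃ λ c → c + c ≡ N
    nonNegative (+ c) eq = c , ℤP.+-injective (trans (ℤP.pos-+ c c) eq)

double-injective : ∀ x y → x + x ≡ y + y → x ≡ y
double-injective x y eq = ℕP.*-cancelʳ-≡ x y 2 (trans (x*2≡x+x x) (trans eq (sym (x*2≡x+x y))))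
  where x*2≡x+x : ∀ x → x * 2 ≡ x + x
        x*2≡x+x = ℕ-solve

triangle-1+4q : ∀ q → sumℕ (suc (q * 4)) suc ≡ suc (2 * (q * q * 4 + q * 3))
triangle-1+4q q = double-injective _ _ (trans (gauss (suc (q * 4))) (eq q))
  where eq : ∀ q → suc (q * 4) * suc (suc (q * 4)) ≡ suc (2 * (q * q * 4 + q * 3)) + suc (2 * (q * q * 4 + q * 3))
        eq = ℕ-solve

no-SMA-1mod4 : ∀ q {A} → ¬ IsSMA (suc (q * 4)) 2 A
no-SMA-1mod4 q isSMA = ℕP.even≢odd c (q * q * 4 + q * 3)
  (trans (cong (λ z → c + z) (ℕP.+-identityʳ c)) (trans c+c≡ (triangle-1+4q q)))
  where c = proj₁ (SMA-2Columns.triangle-even isSMA)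
        c+c≡ = proj₂ (SMA-2Columns.triangle-even isSMA)

SMA : ℕ → ℕ → Set
SMA m n = ∃[ A ] (IsSMA m n A × PairsInSameRow m n A)

nearHalves : ∀ {P : ℕ → Set} → (∀ h u → u ≤ h → h ≤ suc u → 1 ≤ h → P (h + u)) → ∀ t → 1 ≤ t → P t
nearHalves {P} p t 1≤t with halves t
... | zero  , inj₁ refl = ⊥-elim (ℕP.<-irrefl refl 1≤t)
... | suc e , inj₁ refl = subst P (eq e) (p (suc e) (suc e) ℕP.≤-refl (ℕP.n≤1+n (suc e)) (s≤s z≤n))
  where eq : ∀ e → suc e + suc e ≡ suc e * 2 + 0
        eq = ℕ-solve
... | e , inj₂ refl = subst P (eq e) (p (suc e) e (ℕP.n≤1+n e) ℕP.≤-refl (s≤s z≤n))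
  where eq : ∀ e → suc e + e ≡ e * 2 + 1
        eq = ℕ-solve

sma-3+4q : ∀ q t → 1 ≤ t → SMA (3 + q * 4) (t * 2)
sma-3+4q q t 1≤t = subst (SMA _) (t+t≡t*2 t) (magicBlock⇒SMA (magic+4* (nearHalves {MagicBlock 3} magic3 t 1≤t) q))
  where t+t≡t*2 : ∀ t → t + t ≡ t * 2
        t+t≡t*2 = ℕ-solve

sma-5+4q : ∀ q t → 2 ≤ t → SMA (5 + q * 4) (t * 2)
sma-5+4q q t 2≤t = subst (SMA _) (t+t≡t*2 t) (magicBlock⇒SMA (magic+4* (nearHalves {λ t → 2 ≤ t → MagicBlock 5 t} magic5′ t (ℕP.≤-trans (s≤s z≤n) 2≤t) 2≤t) q))
  where t+t≡t*2 : ∀ t → t + t ≡ t * 2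
        t+t≡t*2 = ℕ-solve
        magic5′ : ∀ h u → u ≤ h → h ≤ suc u → 1 ≤ h → 2 ≤ h + u → MagicBlock 5 (h + u)
        magic5′ h u u≤h h≤1+u 1≤h 2≤t = magic5 h u u≤h h≤1+u 1≤h (patternOfHalfWidth (h + u) 2≤t)

data OddResidue (m : ℕ) : Set where
  one   : ∀ q → m ≡ 1 + q * 4 → m % 4 ≡ 1 → OddResidue m
  three : ∀ q → m ≡ 3 + q * 4 → m % 4 ≡ 3 → OddResidue m

oddResidue : ∀ m → ¬ (2 ∣ m) → OddResidue m
oddResidue m m-odd with m % 4 in eq | m≡m%n+[m/n]*n m 4 | m%n<n m 4
... | 0 | m≡ | _ = ⊥-elim (m-odd (divides (m / 4 * 2) (trans m≡ (e (m / 4)))))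
  where e : ∀ q → 0 + q * 4 ≡ q * 2 * 2
        e = ℕ-solve
... | 1 | m≡ | _ = one (m / 4) m≡ eq
... | 2 | m≡ | _ = ⊥-elim (m-odd (divides (1 + m / 4 * 2) (trans m≡ (e (m / 4)))))
  where e : ∀ q → 2 + q * 4 ≡ (1 + q * 2) * 2
        e = ℕ-solve
... | 3 | m≡ | _ = three (m / 4) m≡ eq
... | suc (suc (suc (suc _))) | _ | s≤s (s≤s (s≤s (s≤s ())))

residue-unique : ∀ m {a b} → m % 4 ≡ a → m % 4 ≡ b → a ≢ b → ⊥
residue-unique m m%4≡a m%4≡b a≢b = a≢b (trans (sym m%4≡a) m%4≡b)

wideSMA : ∀ {m} t → 3 ≤ m → OddResidue m → SMA m (suc (suc t) * 2)
wideSMA t 3≤m (three q refl _)     = sma-3+4q q (suc (suc t)) (s≤s z≤n)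
wideSMA t 3≤m (one zero m≡1 _)    = ⊥-elim (3≰1 (subst (3 ≤_) m≡1 3≤m))
  where 3≰1 : ¬ (3 ≤ 1)
        3≰1 (s≤s ())
wideSMA t 3≤m (one (suc q) refl _) = sma-5+4q q (suc (suc t)) (s≤s (s≤s z≤n))

theorem3p3 : (m n : ℕ) → 3 ≤ m → ¬ (2 ∣ m) → 1 ≤ n → 2 ∣ n →
    (∃[ A ] (IsSMA m n A × PairsInSameRow m n A))
      ⇔ ((((m % 4 ≡ 0) ⊎ (m % 4 ≡ 3)) × n ≡ 2) ⊎ (3 ≤ m × 4 ≤ n))
theorem3p3 m .(0 * 2) _ _ () (divides zero refl)
theorem3p3 m .(1 * 2) 3≤m m-odd _ (divides 1 refl) = mk⇔ necessary sufficient
  where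
  necessary : SMA m 2 → (((m % 4 ≡ 0) ⊎ (m % 4 ≡ 3)) × 2 ≡ 2) ⊎ (3 ≤ m × 4 ≤ 2)
  necessary (_ , isSMA , _) with oddResidue m m-odd
  ... | three _ _ m%4≡3 = inj₁ (inj₂ m%4≡3 , refl)
  ... | one q refl _    = ⊥-elim (no-SMA-1mod4 q isSMA)
  sufficient : (((m % 4 ≡ 0) ⊎ (m % 4 ≡ 3)) × 2 ≡ 2) ⊎ (3 ≤ m × 4 ≤ 2) → SMA m 2
  sufficient (inj₂ (_ , s≤s (s≤s ())))
  sufficient (inj₁ (m%4≡r , _)) with oddResidue m m-odd | m%4≡r
  ... | three q refl _  | inj₂ _      = sma-3+4q q 1 (s≤s z≤n)
  ... | three _ _ m%4≡3 | inj₁ m%4≡0 = ⊥-elim (residue-unique m m%4≡3 m%4≡0 (λ ()))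
  ... | one _ _ m%4≡1   | inj₁ m%4≡0 = ⊥-elim (residue-unique m m%4≡1 m%4≡0 (λ ()))
  ... | one _ _ m%4≡1   | inj₂ m%4≡3 = ⊥-elim (residue-unique m m%4≡1 m%4≡3 (λ ()))
theorem3p3 m .(suc (suc t) * 2) 3≤m m-odd _ (divides (suc (suc t)) refl) =
  mk⇔ (λ _ → inj₂ (3≤m , s≤s (s≤s (s≤s (s≤s z≤n))))) (λ _ → wideSMA t 3≤m (oddResidue m m-odd))
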